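{- Let $m,n\geq1$ be integers and $\mathbf r=(r_1,\dots,r_m)$ a sequence of nonnegative integers with $|\mathbf r|=r_1+\cdots+r_m>0$. Then the numbers $c_k^{(\mathbf r)}$, $1\le k\le n$, defined below, are nonnegative integers.
   Context: For a partition $\mu=(\mu_1\geq\cdots\geq\mu_l>0)$ of $n=|\mu|$, $l(\mu)=l$ is its length, $m_i(\mu)$ the multiplicity of the part $i$, and $z_\mu=\prod_{i\ge1}i^{m_i(\mu)}m_i(\mu)!$. The rising factorial is $(x)_s=x(x+1)\cdots(x+s-1)$, with $(x)_0=1$. Since the polynomials $\binom{X+n-1}{n-k}$, $1\le k\le n$, form a basis of the polynomials in $X$ of degree at most $n-1$, there exist unique rational numbers $c_k^{(\mathbf r)}$ ($1\le k\le n$) such that $$\sum_{|\mu|=n}\frac{X^{l(\mu)-1}}{z_\mu}\left(\sum_{i=1}^{l(\mu)}\prod_{k=1}^m\frac{(\mu_i)_{r_k}}{r_k!}\right)=\frac{1}{|\mathbf r|}\sum_{k=1}^{n}c_k^{(\mathbf r)}\binom{X+n-1}{n-k},$$ the sum being over all partitions $\mu$ of $n$. -}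

module Defs where

open import Data.Bool using (Bool; true; false; _∧_; if_then_else_)
open import Data.Nat as ℕ using (ℕ; zero; suc; _∸_; _≤ᵇ_; _≡ᵇ_)
open import Data.Nat using (_!)
open import Data.Fin using (Fin; toℕ)
open import Data.List using (List; []; _∷_; map; concatMap; filter; length; upTo; foldr; allFin)
open import Data.Integer using (+_)
open import Data.Rational using (ℚ; 0ℚ; 1ℚ; _+_; _*_; _-_; _/_)
open import Relation.Nullary.Decidable using (T?)

sumℚ : List ℚ → ℚ
sumℚ = foldr _+_ 0ℚ

prodℚ : List ℚ → ℚ
prodℚ = foldr _*_ 1ℚ

sumℕ : List ℕ → ℕ
sumℕ = foldr ℕ._+_ 0

prodℕ : List ℕ → ℕ
prodℕ = foldr ℕ._*_ 1

ℕ→ℚ : ℕ → ℚ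
ℕ→ℚ k = (+ k) / 1

-- reciprocal of a natural number (only ever applied to positive numbers
-- in the statement; the value at 0 is an irrelevant convention)
inv : ℕ → ℚ
inv zero    = 0ℚ
inv (suc k) = (+ 1) / suc k

_^ℚ_ : ℚ → ℕ → ℚ
x ^ℚ zero  = 1ℚ
x ^ℚ suc k = x * (x ^ℚ k)

rising : ℕ → ℕ → ℕ
rising x s = prodℕ (map (λ j → x ℕ.+ j) (upTo s))

binomℚ : ℚ → ℕ → ℚ
binomℚ y j = prodℚ (map (λ t → y - ℕ→ℚ t) (upTo j)) * inv (j !)

listsOf : ℕ → ℕ → List (List ℕ)
listsOf zero    n = [] ∷ []
listsOf (suc l) n = concatMap (λ a → map (a ∷_) (listsOf l n)) (map suc (upTo n))

nonincreasing : List ℕ → Bool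
nonincreasing []           = true
nonincreasing (a ∷ [])     = true
nonincreasing (a ∷ b ∷ xs) = (b ≤ᵇ a) ∧ nonincreasing (b ∷ xs)

isPartitionOf : ℕ → List ℕ → Bool
isPartitionOf n μ = nonincreasing μ ∧ (sumℕ μ ≡ᵇ n)

partitions : ℕ → List (List ℕ)
partitions n =
  filter (λ μ → T? (isPartitionOf n μ))
         (concatMap (λ l → listsOf l n) (upTo (suc n)))

mult : ℕ → List ℕ → ℕ
mult i []       = 0
mult i (a ∷ μ)  = if a ≡ᵇ i then suc (mult i μ) else mult i μ

-- z_μ = ∏_{i ≥ 1} i^{m_i(μ)} m_i(μ)!   (parts are ≤ |μ|, so i ranges over 1..|μ|)
z : List ℕ → ℕ
z μ = prodℕ (map (λ i → (i ℕ.^ mult i μ) ℕ.* (mult i μ !)) (map suc (upTo (sumℕ μ))))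

size : {m : ℕ} → (Fin m → ℕ) → ℕ
size {m} r = sumℕ (map r (allFin m))

innerSum : {m : ℕ} → (Fin m → ℕ) → List ℕ → ℚ
innerSum {m} r μ =
  sumℚ (map (λ μi → prodℚ (map (λ k → ℕ→ℚ (rising μi (r k)) * inv (r k !)) (allFin m))) μ)

lhs : {m : ℕ} → ℕ → (Fin m → ℕ) → ℚ → ℚ
lhs n r X =
  sumℚ (map (λ μ → (X ^ℚ (length μ ∸ 1)) * inv (z μ) * innerSum r μ) (partitions n))

-- (1/|r|) Σ_{k=1}^n c_k binom(X+n-1, n-k);  c is indexed by k-1 ∈ Fin n
rhs : {m : ℕ} → (n : ℕ) → (Fin m → ℕ) → (Fin n → ℚ) → ℚ → ℚ
rhs n r c X =
  inv (size r) *
  sumℚ (map (λ k → c k * binomℚ (X + ℕ→ℚ n - 1ℚ) (n ∸ suc (toℕ k))) (allFin n))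

-- c satisfies the defining polynomial identity (equality of polynomials
-- over ℚ, i.e. equality of their values at every X : ℚ)
Defining : {m : ℕ} → (n : ℕ) → (Fin m → ℕ) → (Fin n → ℚ) → Set
Defining n r c = (X : ℚ) → lhs n r X ≡ rhs n r c X
  where open import Relation.Binary.PropositionalEquality using (_≡_)

{-# OPTIONS --with-K #-}
-- Write F(j) = ∏ₖ (j)_{rₖ} / rₖ!. Since j · mⱼ(μ) / z_μ = 1 / z_{μ∖j}, removing one part j from μ turns
-- the left-hand side into Σ_{j ≤ n} F(j)/j · S_{n-j}(X), where S_N(X) = Σ_{ν ⊢ N} X^{l(ν)} / z_ν; the same
-- identity with F(j) = jX gives N S_N = X Σ_{j<N} S_j, whence S_N(X) = binom(X + N - 1, N).
-- Next, |r| F(y + 1)/(y + 1) is a natural-number valued polynomial in y: F(y + 1) = ∏ₖ binom(y + rₖ, rₖ) and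
-- rₖ binom(y + rₖ, rₖ) = (y + 1) binom(y + rₖ, rₖ - 1), so the product rule divides out y + 1. Its Newton
-- coefficients cₖ (in the basis binom(y, k)) are natural numbers, because each binom(y + r, s) has natural
-- Newton coefficients and these are closed under sums and products. By Chu–Vandermonde,
-- Σ_{y<n} binom(y, k) binom(X + n - y - 2, n - 1 - y) = binom(X + n - 1, n - 1 - k), so the cₖ satisfy the
-- defining identity, and they are its only solution since the binom(Y, e) are linearly independent.
module Submission where

open import Defs
open import Data.Nat using (ℕ; _≥_; _>_; >-nonZero)
open import Data.Fin using (Fin; toℕ)
open import Data.Product using (Σ; _×_; _,_)
open import Data.Rational using (ℚ)
open import Relation.Binary.PropositionalEquality using (_≡_)

module Cast where

  open import Data.Nat as ℕ using (ℕ; zero; suc; NonZero)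
  import Data.Nat.Properties as ℕ
  import Data.Nat.Coprimality as Coprime
  open import Data.Integer as ℤ using (+_)
  import Data.Integer.Properties as ℤ
  open import Data.Rational using (mkℚ; 1ℚ; _+_; _*_; _/_; 1/_)
  open import Data.Rational.Properties using (↥p/↧p≡p; /-cong; *-inverseʳ; *-comm; *-assoc; *-identityˡ)
  open import Data.Rational.Solver using (module +-*-Solver)
  open +-*-Solver
  open import Data.List using (List; []; _∷_; map)
  open import Function using (_∘_)
  open import Relation.Nullary using (contradiction)
  open import Relation.Binary.PropositionalEquality
  open ≡-Reasoning

  -- The normal form of k / 1, on which ℚ's operations compute.
  ℕ→ℚ-normal : ∀ k → ℕ→ℚ k ≡ mkℚ (+ k) 0 (Coprime.sym (Coprime.1-coprimeTo k))
  ℕ→ℚ-normal k = ↥p/↧p≡p (mkℚ (+ k) 0 (Coprime.sym (Coprime.1-coprimeTo k)))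

  ℕ→ℚ-+ : ∀ a b → ℕ→ℚ (a ℕ.+ b) ≡ ℕ→ℚ a + ℕ→ℚ b
  ℕ→ℚ-+ a b = begin
    ℕ→ℚ (a ℕ.+ b)                        ≡⟨ /-cong (cong₂ ℤ._+_ (ℤ.*-identityʳ (+ a)) (ℤ.*-identityʳ (+ b))) refl ⟨
    (+ a ℤ.* + 1 ℤ.+ + b ℤ.* + 1) / 1    ≡⟨ cong₂ _+_ (ℕ→ℚ-normal a) (ℕ→ℚ-normal b) ⟨
    ℕ→ℚ a + ℕ→ℚ b                        ∎

  ℕ→ℚ-* : ∀ a b → ℕ→ℚ (a ℕ.* b) ≡ ℕ→ℚ a * ℕ→ℚ b
  ℕ→ℚ-* a b = begin
    ℕ→ℚ (a ℕ.* b)        ≡⟨ /-cong (ℤ.pos-* a b) refl ⟩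
    (+ a ℤ.* + b) / 1    ≡⟨ cong₂ _*_ (ℕ→ℚ-normal a) (ℕ→ℚ-normal b) ⟨
    ℕ→ℚ a * ℕ→ℚ b        ∎

  ℕ→ℚ-suc : ∀ a → ℕ→ℚ (suc a) ≡ ℕ→ℚ a + 1ℚ
  ℕ→ℚ-suc a = trans (cong ℕ→ℚ (ℕ.+-comm 1 a)) (ℕ→ℚ-+ a 1)

  ℕ→ℚ-prodℕ : ∀ {A : Set} (f : A → ℕ) xs → prodℚ (map (ℕ→ℚ ∘ f) xs) ≡ ℕ→ℚ (prodℕ (map f xs))
  ℕ→ℚ-prodℕ f []       = refl
  ℕ→ℚ-prodℕ f (x ∷ xs) = trans (cong (ℕ→ℚ (f x) *_) (ℕ→ℚ-prodℕ f xs)) (sym (ℕ→ℚ-* (f x) _))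

  ℕ→ℚ*inv : ∀ a .{{_ : NonZero a}} → ℕ→ℚ a * inv a ≡ 1ℚ
  ℕ→ℚ*inv zero    = contradiction refl (ℕ.≢-nonZero⁻¹ 0)
  ℕ→ℚ*inv (suc k) = begin
    ℕ→ℚ (suc k) * inv (suc k)   ≡⟨ cong₂ _*_ (ℕ→ℚ-normal (suc k)) (↥p/↧p≡p (1/ p)) ⟩
    p * 1/ p                    ≡⟨ *-inverseʳ p ⟩
    1ℚ                          ∎
    where p = mkℚ (+ suc k) 0 (Coprime.sym (Coprime.1-coprimeTo (suc k)))

  inv*ℕ→ℚ : ∀ a .{{_ : NonZero a}} → inv a * ℕ→ℚ a ≡ 1ℚ
  inv*ℕ→ℚ a = trans (*-comm (inv a) (ℕ→ℚ a)) (ℕ→ℚ*inv a)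

  *-cancelˡ-invertible : ∀ u v {x y} → u * v ≡ 1ℚ → v * x ≡ v * y → x ≡ y
  *-cancelˡ-invertible u v {x} {y} uv≡1 vx≡vy = begin
    x                 ≡⟨ *-identityˡ x ⟨
    1ℚ * x            ≡⟨ cong (_* x) uv≡1 ⟨
    (u * v) * x       ≡⟨ *-assoc u v x ⟩
    u * (v * x)       ≡⟨ cong (u *_) vx≡vy ⟩
    u * (v * y)       ≡⟨ *-assoc u v y ⟨
    (u * v) * y       ≡⟨ cong (_* y) uv≡1 ⟩
    1ℚ * y            ≡⟨ *-identityˡ y ⟩
    y                 ∎

  inv-* : ∀ a b .{{_ : NonZero a}} .{{_ : NonZero b}} → inv (a ℕ.* b) ≡ inv a * inv b
  inv-* a b = *-cancelˡ-invertible (inv (a ℕ.* b)) (ℕ→ℚ (a ℕ.* b)) (inv*ℕ→ℚ (a ℕ.* b) {{ab≢0}}) (begin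
    ℕ→ℚ (a ℕ.* b) * inv (a ℕ.* b)
      ≡⟨ ℕ→ℚ*inv (a ℕ.* b) {{ab≢0}} ⟩
    1ℚ
      ≡⟨ cong₂ _*_ (ℕ→ℚ*inv a) (ℕ→ℚ*inv b) ⟨
    (ℕ→ℚ a * inv a) * (ℕ→ℚ b * inv b)
      ≡⟨ solve 4 (λ x u y v → (x :* u) :* (y :* v) := (x :* y) :* (u :* v)) refl (ℕ→ℚ a) (inv a) (ℕ→ℚ b) (inv b) ⟩
    (ℕ→ℚ a * ℕ→ℚ b) * (inv a * inv b)
      ≡⟨ cong (_* (inv a * inv b)) (ℕ→ℚ-* a b) ⟨
    ℕ→ℚ (a ℕ.* b) * (inv a * inv b) ∎)
    where ab≢0 = ℕ.m*n≢0 a b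

module Sums where

  open import Data.Nat as ℕ using (ℕ; zero; suc; _≤_; _<_)
  import Data.Nat.Properties as ℕ
  open import Data.Fin using (toℕ)
  open import Data.Rational using (ℚ; 0ℚ; _+_; _*_)
  open import Data.Rational.Properties
    using (+-identityˡ; +-identityʳ; +-assoc; +-comm; *-comm; *-zeroʳ; *-distribˡ-+; +-0-isCommutativeMonoid)
  open import Data.Rational.Solver using (module +-*-Solver)
  open import Data.List using (List; []; _∷_; map; upTo; applyUpTo; _++_; concatMap; allFin; tabulate)
  import Data.List.Properties as List
  open import Data.List.Membership.Propositional using (_∈_)
  open import Data.List.Membership.Propositional.Properties using (∈-upTo⁻)
  open import Data.List.Relation.Unary.Any using (here; there)
  open import Data.List.Relation.Binary.Permutation.Propositional using (_↭_; ↭⇒↭ₛ)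
  import Data.List.Relation.Binary.Permutation.Propositional.Properties as Perm
  open import Data.List.Relation.Binary.Permutation.Setoid.Properties using (foldr-commMonoid)
  open import Function using (_∘_)
  open import Relation.Binary.PropositionalEquality
  open ≡-Reasoning
  open +-*-Solver

  private
    variable
      A B : Set

  sumℚ-++ : (xs ys : List ℚ) → sumℚ (xs ++ ys) ≡ sumℚ xs + sumℚ ys
  sumℚ-++ []       ys = sym (+-identityˡ _)
  sumℚ-++ (x ∷ xs) ys = trans (cong (x +_) (sumℚ-++ xs ys)) (sym (+-assoc x _ _))

  sumℚ-cong : ∀ {f g : A → ℚ} xs → (∀ {x} → x ∈ xs → f x ≡ g x) → sumℚ (map f xs) ≡ sumℚ (map g xs)
  sumℚ-cong []       f≗g = refl
  sumℚ-cong (x ∷ xs) f≗g = cong₂ _+_ (f≗g (here refl)) (sumℚ-cong xs (f≗g ∘ there))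

  sumℚ-zero : ∀ {f : A → ℚ} xs → (∀ {x} → x ∈ xs → f x ≡ 0ℚ) → sumℚ (map f xs) ≡ 0ℚ
  sumℚ-zero []       f≗0 = refl
  sumℚ-zero (x ∷ xs) f≗0 = trans (cong₂ _+_ (f≗0 (here refl)) (sumℚ-zero xs (f≗0 ∘ there))) (+-identityˡ 0ℚ)

  sumℚ-+ : ∀ (f g : A → ℚ) xs → sumℚ (map (λ x → f x + g x) xs) ≡ sumℚ (map f xs) + sumℚ (map g xs)
  sumℚ-+ f g []       = refl
  sumℚ-+ f g (x ∷ xs) = trans (cong (f x + g x +_) (sumℚ-+ f g xs))
    (solve 4 (λ a b c d → (a :+ b) :+ (c :+ d) := (a :+ c) :+ (b :+ d)) refl (f x) (g x) _ _)

  sumℚ-*ˡ : ∀ c (f : A → ℚ) xs → sumℚ (map (λ x → c * f x) xs) ≡ c * sumℚ (map f xs)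
  sumℚ-*ˡ c f []       = sym (*-zeroʳ c)
  sumℚ-*ˡ c f (x ∷ xs) = trans (cong (c * f x +_) (sumℚ-*ˡ c f xs)) (sym (*-distribˡ-+ c (f x) _))

  sumℚ-*ʳ : ∀ c (f : A → ℚ) xs → sumℚ (map (λ x → f x * c) xs) ≡ sumℚ (map f xs) * c
  sumℚ-*ʳ c f xs = begin
    sumℚ (map (λ x → f x * c) xs)   ≡⟨ sumℚ-cong xs (λ {x} _ → *-comm (f x) c) ⟩
    sumℚ (map (λ x → c * f x) xs)   ≡⟨ sumℚ-*ˡ c f xs ⟩
    c * sumℚ (map f xs)             ≡⟨ *-comm c _ ⟩
    sumℚ (map f xs) * c             ∎

  sumℚ-concatMap : ∀ (f : B → ℚ) (g : A → List B) xs →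
                   sumℚ (map f (concatMap g xs)) ≡ sumℚ (map (λ x → sumℚ (map f (g x))) xs)
  sumℚ-concatMap f g []       = refl
  sumℚ-concatMap f g (x ∷ xs) = begin
    sumℚ (map f (g x ++ concatMap g xs))                   ≡⟨ cong sumℚ (List.map-++ f (g x) _) ⟩
    sumℚ (map f (g x) ++ map f (concatMap g xs))           ≡⟨ sumℚ-++ (map f (g x)) _ ⟩
    sumℚ (map f (g x)) + sumℚ (map f (concatMap g xs))     ≡⟨ cong (sumℚ (map f (g x)) +_) (sumℚ-concatMap f g xs) ⟩
    sumℚ (map (λ x → sumℚ (map f (g x))) (x ∷ xs))        ∎

  sumℚ-swap : ∀ (f : A → B → ℚ) xs ys →
              sumℚ (map (λ x → sumℚ (map (f x) ys)) xs) ≡ sumℚ (map (λ y → sumℚ (map (λ x → f x y) xs)) ys)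
  sumℚ-swap f []       ys = sym (sumℚ-zero ys (λ _ → refl))
  sumℚ-swap f (x ∷ xs) ys = trans (cong (sumℚ (map (f x) ys) +_) (sumℚ-swap f xs ys))
                                  (sym (sumℚ-+ (f x) (λ y → sumℚ (map (λ x → f x y) xs)) ys))

  sumℚ-↭ : ∀ (f : A → ℚ) {xs ys} → xs ↭ ys → sumℚ (map f xs) ≡ sumℚ (map f ys)
  sumℚ-↭ f xs↭ys = foldr-commMonoid (setoid ℚ) +-0-isCommutativeMonoid (↭⇒↭ₛ (Perm.map⁺ f xs↭ys))

  ∑< : ℕ → (ℕ → ℚ) → ℚ
  ∑< n f = sumℚ (map f (upTo n))

  syntax ∑< n (λ i → t) = ∑[ i < n ] t

  ∑<-cong : ∀ n {f g} → (∀ {i} → i < n → f i ≡ g i) → ∑< n f ≡ ∑< n g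
  ∑<-cong n f≗g = sumℚ-cong (upTo n) (f≗g ∘ ∈-upTo⁻)

  ∑<-zero : ∀ n {f} → (∀ {i} → i < n → f i ≡ 0ℚ) → ∑< n f ≡ 0ℚ
  ∑<-zero n f≗0 = sumℚ-zero (upTo n) (f≗0 ∘ ∈-upTo⁻)

  ∑<-+ : ∀ n f g → ∑[ i < n ] (f i + g i) ≡ ∑< n f + ∑< n g
  ∑<-+ n f g = sumℚ-+ f g (upTo n)

  ∑<-*ˡ : ∀ n c f → ∑[ i < n ] (c * f i) ≡ c * ∑< n f
  ∑<-*ˡ n c f = sumℚ-*ˡ c f (upTo n)

  ∑<-*ʳ : ∀ n c f → ∑[ i < n ] (f i * c) ≡ ∑< n f * c
  ∑<-*ʳ n c f = sumℚ-*ʳ c f (upTo n)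

  ∑<-swap : ∀ m n (f : ℕ → ℕ → ℚ) → ∑[ i < m ] ∑< n (f i) ≡ ∑[ j < n ] ∑[ i < m ] f i j
  ∑<-swap m n f = sumℚ-swap f (upTo m) (upTo n)

  ∑<-suc : ∀ n f → ∑< (suc n) f ≡ ∑< n f + f n
  ∑<-suc n f = begin
    sumℚ (map f (upTo (suc n)))            ≡⟨ cong (sumℚ ∘ map f) (List.upTo-∷ʳ n) ⟨
    sumℚ (map f (upTo n ++ n ∷ []))        ≡⟨ cong sumℚ (List.map-++ f (upTo n) (n ∷ [])) ⟩
    sumℚ (map f (upTo n) ++ f n ∷ [])      ≡⟨ sumℚ-++ (map f (upTo n)) (f n ∷ []) ⟩
    ∑< n f + (f n + 0ℚ)                    ≡⟨ cong (∑< n f +_) (+-identityʳ (f n)) ⟩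
    ∑< n f + f n                           ∎

  ∑<-suc-head : ∀ n f → ∑< (suc n) f ≡ f 0 + ∑[ i < n ] f (suc i)
  ∑<-suc-head n f = cong (λ xs → f 0 + sumℚ xs)
    (trans (List.map-applyUpTo suc f n) (sym (List.map-upTo (f ∘ suc) n)))

  ∑<-extend : ∀ m n f → m ≤ n → (∀ {i} → m ≤ i → f i ≡ 0ℚ) → ∑< n f ≡ ∑< m f
  ∑<-extend m n f m≤n f≗0 = trans (cong (λ k → ∑< k f) (sym (ℕ.m+[n∸m]≡n m≤n))) (go (n ℕ.∸ m))
    where
    go : ∀ k → ∑< (m ℕ.+ k) f ≡ ∑< m f
    go zero    = cong (λ k → ∑< k f) (ℕ.+-identityʳ m)
    go (suc k) = begin
      ∑< (m ℕ.+ suc k) f                   ≡⟨ cong (λ k → ∑< k f) (ℕ.+-suc m k) ⟩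
      ∑< (suc (m ℕ.+ k)) f                 ≡⟨ ∑<-suc (m ℕ.+ k) f ⟩
      ∑< (m ℕ.+ k) f + f (m ℕ.+ k)         ≡⟨ cong₂ _+_ (go k) (f≗0 (ℕ.m≤m+n m k)) ⟩
      ∑< m f + 0ℚ                          ≡⟨ +-identityʳ _ ⟩
      ∑< m f                               ∎

  ∑<-reverse : ∀ n f → ∑[ k < n ] f (n ℕ.∸ suc k) ≡ ∑< n f
  ∑<-reverse zero    f = refl
  ∑<-reverse (suc n) f = begin
    ∑[ k < suc n ] f (suc n ℕ.∸ suc k)           ≡⟨ ∑<-suc-head n (λ k → f (suc n ℕ.∸ suc k)) ⟩
    f n + ∑[ k < n ] f (n ℕ.∸ suc k)             ≡⟨ cong (f n +_) (∑<-reverse n f) ⟩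
    f n + ∑< n f                                 ≡⟨ +-comm (f n) (∑< n f) ⟩
    ∑< n f + f n                                 ≡⟨ ∑<-suc n f ⟨
    ∑< (suc n) f                                 ∎

  ∑<-allFin : ∀ n (f : ℕ → ℚ) → sumℚ (map (f ∘ toℕ) (allFin n)) ≡ ∑< n f
  ∑<-allFin n f = cong sumℚ (begin
    map (f ∘ toℕ) (allFin n)      ≡⟨ List.map-tabulate (λ k → k) (f ∘ toℕ) ⟩
    tabulate (f ∘ toℕ)            ≡⟨ tabulate-toℕ n f ⟩
    applyUpTo f n                 ≡⟨ List.map-upTo f n ⟨
    map f (upTo n)                ∎)
    where
    tabulate-toℕ : ∀ n (f : ℕ → A) → tabulate {n = n} (f ∘ toℕ) ≡ applyUpTo f n
    tabulate-toℕ zero    f = refl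
    tabulate-toℕ (suc n) f = cong (f 0 ∷_) (tabulate-toℕ n (f ∘ suc))

module Binomial where

  open import Data.Nat as ℕ using (ℕ; zero; suc; _≤_; _<_; _∸_; _!)
  import Data.Nat.Properties as ℕ
  open import Data.Nat.Combinatorics using (_C_; k>n⇒nCk≡0; nCn≡1; nCk+nC[k+1]≡[n+1]C[k+1])
  open import Data.Sum using (inj₁; inj₂)
  open import Data.Rational using (ℚ; 0ℚ; 1ℚ; _+_; _*_; _-_)
  open import Data.Rational.Properties
    using (+-comm; +-assoc; +-identityˡ; +-identityʳ; *-zeroˡ; *-zeroʳ; *-identityˡ; *-identityʳ; *-assoc; *-distribʳ-+; +-0-group)
  open import Algebra.Properties.Group +-0-group using (∙-cancelˡ)
  open import Data.Rational.Solver using (module +-*-Solver)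
  open import Data.List using (map; upTo; applyUpTo)
  import Data.List.Properties as List
  open import Relation.Binary.PropositionalEquality
  open ≡-Reasoning
  open +-*-Solver
  open Cast
  open Sums

  falling : ℚ → ℕ → ℚ
  falling y j = prodℚ (map (λ t → y - ℕ→ℚ t) (upTo j))

  falling-suc-head : ∀ y j → falling y (suc j) ≡ y * falling (y - 1ℚ) j
  falling-suc-head y j = cong₂ _*_
    (solve 1 (λ y → y :- con 0ℚ := y) refl y)
    (cong prodℚ (begin
      map (λ t → y - ℕ→ℚ t) (applyUpTo suc j)             ≡⟨ List.map-applyUpTo suc _ j ⟩
      applyUpTo (λ t → y - ℕ→ℚ (suc t)) j                 ≡⟨ List.map-upTo _ j ⟨
      map (λ t → y - ℕ→ℚ (suc t)) (upTo j)                ≡⟨ List.map-cong shift (upTo j) ⟩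
      map (λ t → (y - 1ℚ) - ℕ→ℚ t) (upTo j)               ∎))
    where
    shift : ∀ t → y - ℕ→ℚ (suc t) ≡ (y - 1ℚ) - ℕ→ℚ t
    shift t = trans (cong (y -_) (ℕ→ℚ-suc t)) (solve 2 (λ y a → y :- (a :+ con 1ℚ) := (y :- con 1ℚ) :- a) refl y (ℕ→ℚ t))

  falling-suc : ∀ y j → falling y (suc j) ≡ falling y j * (y - ℕ→ℚ j)
  falling-suc y zero    = solve 1 (λ a → a :* con 1ℚ := con 1ℚ :* a) refl (y - 0ℚ)
  falling-suc y (suc j) = begin
    falling y (suc (suc j))                                ≡⟨ falling-suc-head y (suc j) ⟩
    y * falling (y - 1ℚ) (suc j)                           ≡⟨ cong (y *_) (falling-suc (y - 1ℚ) j) ⟩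
    y * (falling (y - 1ℚ) j * ((y - 1ℚ) - ℕ→ℚ j))          ≡⟨ cong (λ t → y * (falling (y - 1ℚ) j * t)) shift ⟩
    y * (falling (y - 1ℚ) j * (y - ℕ→ℚ (suc j)))           ≡⟨ *-assoc y _ _ ⟨
    (y * falling (y - 1ℚ) j) * (y - ℕ→ℚ (suc j))           ≡⟨ cong (_* (y - ℕ→ℚ (suc j))) (falling-suc-head y j) ⟨
    falling y (suc j) * (y - ℕ→ℚ (suc j))                  ∎
    where
    shift : (y - 1ℚ) - ℕ→ℚ j ≡ y - ℕ→ℚ (suc j)
    shift = trans (solve 2 (λ y a → (y :- con 1ℚ) :- a := y :- (a :+ con 1ℚ)) refl y (ℕ→ℚ j)) (cong (y -_) (sym (ℕ→ℚ-suc j)))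

  inv-suc! : ∀ k → inv (suc k !) ≡ inv (suc k) * inv (k !)
  inv-suc! k = inv-* (suc k) (k !) {{_}} {{k ℕ.!≢0}}

  suc*inv-suc! : ∀ k → (ℕ→ℚ k + 1ℚ) * inv (suc k !) ≡ inv (k !)
  suc*inv-suc! k = begin
    (ℕ→ℚ k + 1ℚ) * inv (suc k !)                ≡⟨ cong₂ _*_ (ℕ→ℚ-suc k) (sym (inv-suc! k)) ⟨
    ℕ→ℚ (suc k) * (inv (suc k) * inv (k !))    ≡⟨ *-assoc (ℕ→ℚ (suc k)) _ _ ⟨
    (ℕ→ℚ (suc k) * inv (suc k)) * inv (k !)    ≡⟨ cong (_* inv (k !)) (ℕ→ℚ*inv (suc k)) ⟩
    1ℚ * inv (k !)                             ≡⟨ solve 1 (λ a → con 1ℚ :* a := a) refl (inv (k !)) ⟩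
    inv (k !)                                  ∎

  binomℚ-pascal : ∀ y k → binomℚ (y + 1ℚ) (suc k) ≡ binomℚ y (suc k) + binomℚ y k
  binomℚ-pascal y k = begin
    falling (y + 1ℚ) (suc k) * v′
      ≡⟨ cong (_* v′) (falling-suc-head (y + 1ℚ) k) ⟩
    ((y + 1ℚ) * falling (y + 1ℚ - 1ℚ) k) * v′
      ≡⟨ cong (λ t → ((y + 1ℚ) * falling t k) * v′) (solve 1 (λ y → y :+ con 1ℚ :- con 1ℚ := y) refl y) ⟩
    ((y + 1ℚ) * F) * v′
      ≡⟨ solve 4 (λ y K F v′ → ((y :+ con 1ℚ) :* F) :* v′ := (F :* (y :- K)) :* v′ :+ F :* ((K :+ con 1ℚ) :* v′))
                 refl y K F v′ ⟩
    (F * (y - K)) * v′ + F * ((K + 1ℚ) * v′)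
      ≡⟨ cong₂ (λ s t → s * v′ + F * t) (sym (falling-suc y k)) (suc*inv-suc! k) ⟩
    binomℚ y (suc k) + binomℚ y k ∎
    where
    F  = falling y k
    K  = ℕ→ℚ k
    v′ = inv (suc k !)

  binomℚ-absorb : ∀ y k → ℕ→ℚ (suc k) * binomℚ y (suc k) ≡ (y - ℕ→ℚ k) * binomℚ y k
  binomℚ-absorb y k = begin
    ℕ→ℚ (suc k) * (falling y (suc k) * v′)
      ≡⟨ cong₂ (λ s t → s * (t * v′)) (ℕ→ℚ-suc k) (falling-suc y k) ⟩
    (K + 1ℚ) * ((F * (y - K)) * v′)
      ≡⟨ solve 4 (λ y K F v′ → (K :+ con 1ℚ) :* ((F :* (y :- K)) :* v′) := (y :- K) :* (F :* ((K :+ con 1ℚ) :* v′)))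
                 refl y K F v′ ⟩
    (y - K) * (F * ((K + 1ℚ) * v′))
      ≡⟨ cong (λ t → (y - K) * (F * t)) (suc*inv-suc! k) ⟩
    (y - K) * binomℚ y k ∎
    where
    F  = falling y k
    K  = ℕ→ℚ k
    v′ = inv (suc k !)

  binomℚ-ℕ : ∀ t j → binomℚ (ℕ→ℚ t) j ≡ ℕ→ℚ (t C j)
  binomℚ-ℕ t       zero    = refl
  binomℚ-ℕ zero    (suc j) = begin
    falling 0ℚ (suc j) * inv (suc j !)                  ≡⟨ cong (_* inv (suc j !)) (falling-suc-head 0ℚ j) ⟩
    (0ℚ * falling (0ℚ - 1ℚ) j) * inv (suc j !)          ≡⟨ cong (_* inv (suc j !)) (*-zeroˡ (falling (0ℚ - 1ℚ) j)) ⟩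
    0ℚ * inv (suc j !)                                  ≡⟨ *-zeroˡ (inv (suc j !)) ⟩
    0ℚ                                                  ∎
  binomℚ-ℕ (suc t) (suc j) = begin
    binomℚ (ℕ→ℚ (suc t)) (suc j)                        ≡⟨ cong (λ y → binomℚ y (suc j)) (ℕ→ℚ-suc t) ⟩
    binomℚ (ℕ→ℚ t + 1ℚ) (suc j)                         ≡⟨ binomℚ-pascal (ℕ→ℚ t) j ⟩
    binomℚ (ℕ→ℚ t) (suc j) + binomℚ (ℕ→ℚ t) j          ≡⟨ cong₂ _+_ (binomℚ-ℕ t (suc j)) (binomℚ-ℕ t j) ⟩
    ℕ→ℚ (t C suc j) + ℕ→ℚ (t C j)                       ≡⟨ +-comm (ℕ→ℚ (t C suc j)) (ℕ→ℚ (t C j)) ⟩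
    ℕ→ℚ (t C j) + ℕ→ℚ (t C suc j)                       ≡⟨ ℕ→ℚ-+ (t C j) _ ⟨
    ℕ→ℚ (t C j ℕ.+ t C suc j)                           ≡⟨ cong ℕ→ℚ (nCk+nC[k+1]≡[n+1]C[k+1] t j) ⟩
    ℕ→ℚ (suc t C suc j)                                 ∎

  multichoose : ℚ → ℕ → ℚ
  multichoose X N = binomℚ (X + ℕ→ℚ N - 1ℚ) N

  private
    suc-arg : ∀ X N → X + ℕ→ℚ (suc N) - 1ℚ ≡ X + ℕ→ℚ N
    suc-arg X N = trans (cong (λ t → X + t - 1ℚ) (ℕ→ℚ-suc N))
                        (solve 2 (λ X a → X :+ (a :+ con 1ℚ) :- con 1ℚ := X :+ a) refl X (ℕ→ℚ N))

    plus1-arg : ∀ X N → X + 1ℚ + ℕ→ℚ N - 1ℚ ≡ X + ℕ→ℚ N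
    plus1-arg X N = solve 2 (λ X a → X :+ con 1ℚ :+ a :- con 1ℚ := X :+ a) refl X (ℕ→ℚ N)

  multichoose-pascal : ∀ N Z → multichoose (Z + 1ℚ) (suc N) ≡ multichoose (Z + 1ℚ) N + multichoose Z (suc N)
  multichoose-pascal N Z = begin
    multichoose (Z + 1ℚ) (suc N)
      ≡⟨ cong (λ y → binomℚ y (suc N)) (trans (suc-arg (Z + 1ℚ) N) (+-assoc Z 1ℚ _)) ⟩
    binomℚ (Z + (1ℚ + ℕ→ℚ N)) (suc N)
      ≡⟨ cong (λ y → binomℚ (Z + y) (suc N)) (+-comm 1ℚ (ℕ→ℚ N)) ⟩
    binomℚ (Z + (ℕ→ℚ N + 1ℚ)) (suc N)
      ≡⟨ cong (λ y → binomℚ y (suc N)) (+-assoc Z (ℕ→ℚ N) 1ℚ) ⟨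
    binomℚ (W + 1ℚ) (suc N)
      ≡⟨ binomℚ-pascal W N ⟩
    binomℚ W (suc N) + binomℚ W N
      ≡⟨ +-comm (binomℚ W (suc N)) (binomℚ W N) ⟩
    binomℚ W N + binomℚ W (suc N)
      ≡⟨ cong₂ (λ a b → binomℚ a N + binomℚ b (suc N)) (plus1-arg Z N) (suc-arg Z N) ⟨
    multichoose (Z + 1ℚ) N + multichoose Z (suc N) ∎
    where W = Z + ℕ→ℚ N

  multichoose-absorb : ∀ N X → ℕ→ℚ (suc N) * multichoose X (suc N) ≡ X * multichoose (X + 1ℚ) N
  multichoose-absorb N X = begin
    ℕ→ℚ (suc N) * multichoose X (suc N)
      ≡⟨ cong (λ y → ℕ→ℚ (suc N) * binomℚ y (suc N)) (suc-arg X N) ⟩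
    ℕ→ℚ (suc N) * binomℚ W (suc N)
      ≡⟨ binomℚ-absorb W N ⟩
    (W - ℕ→ℚ N) * binomℚ W N
      ≡⟨ cong₂ (λ a b → a * binomℚ b N) (solve 2 (λ X a → X :+ a :- a := X) refl X (ℕ→ℚ N)) (sym (plus1-arg X N)) ⟩
    X * multichoose (X + 1ℚ) N ∎
    where W = X + ℕ→ℚ N

  multichoose-hockey : ∀ N X → ∑[ j < suc N ] multichoose X (N ∸ j) ≡ multichoose (X + 1ℚ) N
  multichoose-hockey zero    X = refl
  multichoose-hockey (suc N) X = begin
    ∑[ j < suc (suc N) ] multichoose X (suc N ∸ j)
      ≡⟨ ∑<-suc-head (suc N) (λ j → multichoose X (suc N ∸ j)) ⟩
    multichoose X (suc N) + ∑[ j < suc N ] multichoose X (N ∸ j)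
      ≡⟨ cong (multichoose X (suc N) +_) (multichoose-hockey N X) ⟩
    multichoose X (suc N) + multichoose (X + 1ℚ) N
      ≡⟨ +-comm (multichoose X (suc N)) _ ⟩
    multichoose (X + 1ℚ) N + multichoose X (suc N)
      ≡⟨ multichoose-pascal N X ⟨
    multichoose (X + 1ℚ) (suc N) ∎

  module _ (X : ℚ) where

    private
      convolution : ℕ → ℕ → ℚ
      convolution k n = ∑[ y < n ] (ℕ→ℚ (y C k) * multichoose X (n ∸ suc y))

      convolution-below : ∀ {k n} → n ≤ k → convolution k n ≡ 0ℚ
      convolution-below {k} {n} n≤k = ∑<-zero n λ {y} y<n →
        trans (cong (λ c → ℕ→ℚ c * multichoose X (n ∸ suc y)) (k>n⇒nCk≡0 (ℕ.<-≤-trans y<n n≤k)))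
              (*-zeroˡ (multichoose X (n ∸ suc y)))

      convolution-suc : ∀ k n → convolution (suc k) (suc n) ≡ convolution (suc k) n + convolution k n
      convolution-suc k n = begin
        convolution (suc k) (suc n)
          ≡⟨ ∑<-suc-head n (λ y → ℕ→ℚ (y C suc k) * multichoose X (suc n ∸ suc y)) ⟩
        0ℚ * multichoose X n + ∑[ y < n ] (ℕ→ℚ (suc y C suc k) * M y)
          ≡⟨ cong₂ _+_ (*-zeroˡ (multichoose X n)) (∑<-cong n (λ {y} _ → pascal y)) ⟩
        0ℚ + ∑[ y < n ] (ℕ→ℚ (y C suc k) * M y + ℕ→ℚ (y C k) * M y)
          ≡⟨ +-identityˡ _ ⟩
        ∑[ y < n ] (ℕ→ℚ (y C suc k) * M y + ℕ→ℚ (y C k) * M y)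
          ≡⟨ ∑<-+ n _ _ ⟩
        convolution (suc k) n + convolution k n ∎
        where
        M : ℕ → ℚ
        M y = multichoose X (n ∸ suc y)
        pascal : ∀ y → ℕ→ℚ (suc y C suc k) * M y ≡ ℕ→ℚ (y C suc k) * M y + ℕ→ℚ (y C k) * M y
        pascal y = begin
          ℕ→ℚ (suc y C suc k) * M y
            ≡⟨ cong (λ c → ℕ→ℚ c * M y) (nCk+nC[k+1]≡[n+1]C[k+1] y k) ⟨
          ℕ→ℚ (y C k ℕ.+ y C suc k) * M y
            ≡⟨ cong (_* M y) (trans (cong ℕ→ℚ (ℕ.+-comm (y C k) _)) (ℕ→ℚ-+ (y C suc k) (y C k))) ⟩
          (ℕ→ℚ (y C suc k) + ℕ→ℚ (y C k)) * M y
            ≡⟨ *-distribʳ-+ (M y) (ℕ→ℚ (y C suc k)) (ℕ→ℚ (y C k)) ⟩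
          ℕ→ℚ (y C suc k) * M y + ℕ→ℚ (y C k) * M y ∎

      convolution-zero : ∀ N → convolution 0 (suc N) ≡ multichoose (X + 1ℚ) N
      convolution-zero N = trans (∑<-cong (suc N) (λ {j} _ → *-identityˡ (multichoose X (N ∸ j))))
                                 (multichoose-hockey N X)

      convolution-closed : ∀ k N → convolution k (suc (k ℕ.+ N)) ≡ multichoose (X + ℕ→ℚ (suc k)) N
      convolution-closed zero    N       = convolution-zero N
      convolution-closed (suc k) zero    = begin
        convolution (suc k) (suc (suc k ℕ.+ 0))
          ≡⟨ convolution-suc k (suc k ℕ.+ 0) ⟩
        convolution (suc k) (suc k ℕ.+ 0) + convolution k (suc (k ℕ.+ 0))
          ≡⟨ cong₂ _+_ (convolution-below (ℕ.≤-reflexive (ℕ.+-identityʳ (suc k)))) (convolution-closed k 0) ⟩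
        0ℚ + 1ℚ
          ≡⟨ +-identityˡ 1ℚ ⟩
        multichoose (X + ℕ→ℚ (suc (suc k))) 0 ∎
      convolution-closed (suc k) (suc N) = begin
        convolution (suc k) (suc (suc k ℕ.+ suc N))
          ≡⟨ convolution-suc k (suc k ℕ.+ suc N) ⟩
        convolution (suc k) (suc (k ℕ.+ suc N)) + convolution k (suc (k ℕ.+ suc N))
          ≡⟨ cong₂ _+_ (trans (cong (λ t → convolution (suc k) (suc t)) (ℕ.+-suc k N)) (convolution-closed (suc k) N))
                       (convolution-closed k (suc N)) ⟩
        multichoose (X + ℕ→ℚ (suc (suc k))) N + multichoose Z (suc N)
          ≡⟨ cong (λ t → multichoose t N + multichoose Z (suc N)) Z+1 ⟩
        multichoose (Z + 1ℚ) N + multichoose Z (suc N)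
          ≡⟨ multichoose-pascal N Z ⟨
        multichoose (Z + 1ℚ) (suc N)
          ≡⟨ cong (λ t → multichoose t (suc N)) Z+1 ⟨
        multichoose (X + ℕ→ℚ (suc (suc k))) (suc N) ∎
        where
        Z = X + ℕ→ℚ (suc k)
        Z+1 : X + ℕ→ℚ (suc (suc k)) ≡ Z + 1ℚ
        Z+1 = trans (cong (X +_) (ℕ→ℚ-suc (suc k))) (sym (+-assoc X (ℕ→ℚ (suc k)) 1ℚ))

    -- Chu–Vandermonde, read off from tᵏ (1 - t)^{-k-1} · (1 - t)^{-X} = tᵏ (1 - t)^{-X-k-1}.
    ∑-binomial*multichoose : ∀ n k → k < n →
      ∑[ y < n ] (ℕ→ℚ (y C k) * multichoose X (n ∸ suc y)) ≡ binomℚ (X + ℕ→ℚ n - 1ℚ) (n ∸ suc k)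
    ∑-binomial*multichoose n k k<n = begin
      convolution k n                                  ≡⟨ cong (convolution k) n≡ ⟨
      convolution k (suc (k ℕ.+ N))                    ≡⟨ convolution-closed k N ⟩
      multichoose (X + ℕ→ℚ (suc k)) N                  ≡⟨ cong (λ y → binomℚ y N) argument ⟩
      binomℚ (X + ℕ→ℚ n - 1ℚ) N                        ∎
      where
      N = n ∸ suc k
      n≡ : suc (k ℕ.+ N) ≡ n
      n≡ = ℕ.m+[n∸m]≡n k<n
      argument : X + ℕ→ℚ (suc k) + ℕ→ℚ N - 1ℚ ≡ X + ℕ→ℚ n - 1ℚ
      argument = begin
        X + ℕ→ℚ (suc k) + ℕ→ℚ N - 1ℚ
          ≡⟨ solve 3 (λ X a b → X :+ a :+ b :- con 1ℚ := X :+ (a :+ b) :- con 1ℚ) refl X (ℕ→ℚ (suc k)) (ℕ→ℚ N) ⟩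
        X + (ℕ→ℚ (suc k) + ℕ→ℚ N) - 1ℚ
          ≡⟨ cong (λ t → X + t - 1ℚ) (trans (sym (ℕ→ℚ-+ (suc k) N)) (cong ℕ→ℚ n≡)) ⟩
        X + ℕ→ℚ n - 1ℚ ∎

  binomℚ-basis-unique : ∀ N (a b : ℕ → ℚ) →
    (∀ Y → ∑[ e < N ] (a e * binomℚ Y e) ≡ ∑[ e < N ] (b e * binomℚ Y e)) →
    ∀ {e} → e < N → a e ≡ b e
  binomℚ-basis-unique N a b same = below N ℕ.≤-refl
    where
    -- Evaluating at Y = t sees only the coefficients up to t, the last with weight t C t = 1.
    value : ∀ (c : ℕ → ℚ) {t} → t < N →
            ∑[ e < N ] (c e * binomℚ (ℕ→ℚ t) e) ≡ ∑[ e < t ] (c e * binomℚ (ℕ→ℚ t) e) + c t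
    value c {t} t<N = begin
      ∑[ e < N ] (c e * binomℚ (ℕ→ℚ t) e)
        ≡⟨ ∑<-extend (suc t) N _ t<N vanish ⟩
      ∑[ e < suc t ] (c e * binomℚ (ℕ→ℚ t) e)
        ≡⟨ ∑<-suc t _ ⟩
      ∑[ e < t ] (c e * binomℚ (ℕ→ℚ t) e) + c t * binomℚ (ℕ→ℚ t) t
        ≡⟨ cong (λ v → ∑[ e < t ] (c e * binomℚ (ℕ→ℚ t) e) + c t * v) (trans (binomℚ-ℕ t t) (cong ℕ→ℚ (nCn≡1 t))) ⟩
      ∑[ e < t ] (c e * binomℚ (ℕ→ℚ t) e) + c t * 1ℚ
        ≡⟨ cong (∑[ e < t ] (c e * binomℚ (ℕ→ℚ t) e) +_) (*-identityʳ (c t)) ⟩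
      ∑[ e < t ] (c e * binomℚ (ℕ→ℚ t) e) + c t ∎
      where
      vanish : ∀ {e} → suc t ≤ e → c e * binomℚ (ℕ→ℚ t) e ≡ 0ℚ
      vanish {e} t<e = trans (cong (c e *_) (trans (binomℚ-ℕ t e) (cong ℕ→ℚ (k>n⇒nCk≡0 t<e)))) (*-zeroʳ (c e))

    below : ∀ t → t ≤ N → ∀ {e} → e < t → a e ≡ b e
    below (suc t) t<N e<1+t with ℕ.m<1+n⇒m<n∨m≡n e<1+t
    ... | inj₁ e<t  = below t (ℕ.<⇒≤ t<N) e<t
    ... | inj₂ refl = ∙-cancelˡ (∑[ e < t ] (a e * binomℚ (ℕ→ℚ t) e)) (a t) (b t) (begin
      ∑[ e < t ] (a e * binomℚ (ℕ→ℚ t) e) + a t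
        ≡⟨ value a t<N ⟨
      ∑[ e < N ] (a e * binomℚ (ℕ→ℚ t) e)
        ≡⟨ same (ℕ→ℚ t) ⟩
      ∑[ e < N ] (b e * binomℚ (ℕ→ℚ t) e)
        ≡⟨ value b t<N ⟩
      ∑[ e < t ] (b e * binomℚ (ℕ→ℚ t) e) + b t
        ≡⟨ cong (_+ b t) (∑<-cong t λ {e} e<t → cong (_* binomℚ (ℕ→ℚ t) e) (below t (ℕ.<⇒≤ t<N) e<t)) ⟨
      ∑[ e < t ] (a e * binomℚ (ℕ→ℚ t) e) + b t ∎)

module BinomialIdentities where

  open import Data.Nat
  open import Data.Nat.Properties
  open import Data.Nat.Combinatorics using (_C_; nC1≡n; nCk≡nC[n∸k]; nCk+nC[k+1]≡[n+1]C[k+1])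
  open import Data.Nat.ListAction.Properties using (product-++)
  open import Data.Nat.Solver using (module +-*-Solver)
  open import Data.List using (_∷_; []; map; upTo; _++_)
  import Data.List.Properties as List
  open import Function using (_∘′_)
  open import Relation.Binary.PropositionalEquality
  open ≡-Reasoning
  open +-*-Solver

  C-absorb : ∀ n k → suc k * (suc n C suc k) ≡ suc n * (n C k)
  C-absorb n       zero    = trans (*-identityˡ (suc n C 1)) (trans (nC1≡n (suc n)) (sym (*-identityʳ (suc n))))
  C-absorb zero    (suc k) = *-zeroʳ (suc (suc k))
  C-absorb (suc n) (suc k) = begin
    (2 + k) * (suc (suc n) C suc (suc k))
      ≡⟨ cong ((2 + k) *_) (nCk+nC[k+1]≡[n+1]C[k+1] (suc n) (suc k)) ⟨
    (2 + k) * (a + b)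
      ≡⟨ solve 3 (λ k a b → (con 2 :+ k) :* (a :+ b) := a :+ ((con 1 :+ k) :* a :+ (con 2 :+ k) :* b)) refl k a b ⟩
    a + (suc k * a + suc (suc k) * b)
      ≡⟨ cong₂ (λ s t → a + (s + t)) (C-absorb n k) (C-absorb n (suc k)) ⟩
    a + (suc n * (n C k) + suc n * (n C suc k))
      ≡⟨ cong (a +_) (*-distribˡ-+ (suc n) (n C k) (n C suc k)) ⟨
    a + suc n * (n C k + n C suc k)
      ≡⟨ cong (λ t → a + suc n * t) (nCk+nC[k+1]≡[n+1]C[k+1] n k) ⟩
    a + suc n * a ∎
    where
    a = suc n C suc k
    b = suc n C suc (suc k)

  C-sym : ∀ a b → (a + b) C a ≡ (a + b) C b
  C-sym a b = trans (nCk≡nC[n∸k] (m≤m+n a b)) (cong ((a + b) C_) (m+n∸m≡n a b))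

  -- Both sides equal (y + s + 1) · ((y + s) C s).
  suc*C≡suc*C-suc : ∀ y s → suc y * ((y + suc s) C s) ≡ suc s * ((y + suc s) C suc s)
  suc*C≡suc*C-suc y s = begin
    suc y * ((y + suc s) C s)                ≡⟨ cong (λ n → suc y * (n C s)) (+-suc y s) ⟩
    suc y * ((suc y + s) C s)                ≡⟨ cong (suc y *_) (C-sym (suc y) s) ⟨
    suc y * (suc (y + s) C suc y)            ≡⟨ C-absorb (y + s) y ⟩
    suc (y + s) * ((y + s) C y)              ≡⟨ cong (suc (y + s) *_) (C-sym y s) ⟩
    suc (y + s) * ((y + s) C s)              ≡⟨ C-absorb (y + s) s ⟨
    suc s * (suc (y + s) C suc s)            ≡⟨ cong (λ n → suc s * (n C suc s)) (+-suc y s) ⟨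
    suc s * ((y + suc s) C suc s)            ∎

  rising-suc : ∀ x s → rising x (suc s) ≡ rising x s * (x + s)
  rising-suc x s = begin
    prodℕ (map (x +_) (upTo (suc s)))                ≡⟨ cong (prodℕ ∘′ map (x +_)) (List.upTo-∷ʳ s) ⟨
    prodℕ (map (x +_) (upTo s ++ s ∷ []))            ≡⟨ cong prodℕ (List.map-++ (x +_) (upTo s) (s ∷ [])) ⟩
    prodℕ (map (x +_) (upTo s) ++ (x + s) ∷ [])      ≡⟨ product-++ (map (x +_) (upTo s)) ((x + s) ∷ []) ⟩
    rising x s * ((x + s) * 1)                       ≡⟨ cong (rising x s *_) (*-identityʳ (x + s)) ⟩
    rising x s * (x + s)                             ∎

  rising≡!*C : ∀ y s → rising (suc y) s ≡ s ! * ((y + s) C s)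
  rising≡!*C y zero    = refl
  rising≡!*C y (suc s) = begin
    rising (suc y) (suc s)
      ≡⟨ rising-suc (suc y) s ⟩
    rising (suc y) s * suc (y + s)
      ≡⟨ cong (_* suc (y + s)) (rising≡!*C y s) ⟩
    (s ! * ((y + s) C s)) * suc (y + s)
      ≡⟨ solve 3 (λ f c m → (f :* c) :* m := f :* (m :* c)) refl (s !) ((y + s) C s) (suc (y + s)) ⟩
    s ! * (suc (y + s) * ((y + s) C s))
      ≡⟨ cong (s ! *_) (C-absorb (y + s) s) ⟨
    s ! * (suc s * (suc (y + s) C suc s))
      ≡⟨ solve 3 (λ f m c → f :* (m :* c) := (m :* f) :* c) refl (s !) (suc s) _ ⟩
    suc s ! * (suc (y + s) C suc s)
      ≡⟨ cong (λ n → suc s ! * (n C suc s)) (+-suc y s) ⟨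
    suc s ! * ((y + suc s) C suc s) ∎

module Newton where

  open import Data.Nat
  open import Data.Nat.Properties
  open import Data.Nat.Combinatorics using (_C_; nCk+nC[k+1]≡[n+1]C[k+1])
  open import Data.Nat.Solver using (module +-*-Solver)
  open import Data.List using (List; []; _∷_)
  open import Data.Product using (Σ; _,_)
  open import Relation.Binary.PropositionalEquality
  open ≡-Reasoning
  open +-*-Solver

  -- The function with forward differences c₀, c₁, … at 0, i.e. y ↦ Σₖ cₖ (y C k).
  newton : List ℕ → ℕ → ℕ
  newton []       y       = 0
  newton (c ∷ cs) zero    = c
  newton (c ∷ cs) (suc y) = newton (c ∷ cs) y + newton cs y

  NewtonExpansion : (ℕ → ℕ) → Set
  NewtonExpansion h = Σ (List ℕ) λ cs → ∀ y → h y ≡ newton cs y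

  newton-difference : ∀ (h : ℕ → ℕ) c ds → h 0 ≡ c → (∀ y → h (suc y) ≡ h y + newton ds y) →
                      ∀ y → h y ≡ newton (c ∷ ds) y
  newton-difference h c ds h0 hs zero    = h0
  newton-difference h c ds h0 hs (suc y) = trans (hs y) (cong (_+ newton ds y) (newton-difference h c ds h0 hs y))

  _⊕_ : List ℕ → List ℕ → List ℕ
  []       ⊕ bs       = bs
  (a ∷ as) ⊕ []       = a ∷ as
  (a ∷ as) ⊕ (b ∷ bs) = a + b ∷ as ⊕ bs

  newton-⊕ : ∀ as bs y → newton (as ⊕ bs) y ≡ newton as y + newton bs y
  newton-⊕ []       bs       y       = refl
  newton-⊕ (a ∷ as) []       y       = sym (+-identityʳ _)
  newton-⊕ (a ∷ as) (b ∷ bs) zero    = refl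
  newton-⊕ (a ∷ as) (b ∷ bs) (suc y) = begin
    newton (a + b ∷ as ⊕ bs) y + newton (as ⊕ bs) y
      ≡⟨ cong₂ _+_ (newton-⊕ (a ∷ as) (b ∷ bs) y) (newton-⊕ as bs y) ⟩
    (newton (a ∷ as) y + newton (b ∷ bs) y) + (newton as y + newton bs y)
      ≡⟨ solve 4 (λ u v x z → (u :+ v) :+ (x :+ z) := (u :+ x) :+ (v :+ z)) refl
                 (newton (a ∷ as) y) (newton (b ∷ bs) y) (newton as y) (newton bs y) ⟩
    (newton (a ∷ as) y + newton as y) + (newton (b ∷ bs) y + newton bs y) ∎

  advance : List ℕ → List ℕ
  advance []       = []
  advance (c ∷ cs) = (c ∷ cs) ⊕ cs

  newton-advance : ∀ cs y → newton (advance cs) y ≡ newton cs (suc y)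
  newton-advance []       y = refl
  newton-advance (c ∷ cs) y = newton-⊕ (c ∷ cs) cs y

  -- The recursion is the product rule Δ(uv)(y) = Δu(y) · v(y + 1) + u(y) · Δv(y).
  _⊗_ : List ℕ → List ℕ → List ℕ
  []       ⊗ bs       = []
  (a ∷ as) ⊗ []       = []
  (a ∷ as) ⊗ (b ∷ bs) = a * b ∷ (as ⊗ advance (b ∷ bs)) ⊕ ((a ∷ as) ⊗ bs)

  newton-⊗ : ∀ as bs y → newton (as ⊗ bs) y ≡ newton as y * newton bs y
  newton-⊗ []       bs       y       = refl
  newton-⊗ (a ∷ as) []       y       = sym (*-zeroʳ (newton (a ∷ as) y))
  newton-⊗ (a ∷ as) (b ∷ bs) zero    = refl
  newton-⊗ (a ∷ as) (b ∷ bs) (suc y) = begin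
    newton ((a ∷ as) ⊗ (b ∷ bs)) y + newton ((as ⊗ advance v) ⊕ (u ⊗ bs)) y
      ≡⟨ cong₂ _+_ (newton-⊗ u v y) (newton-⊕ (as ⊗ advance v) (u ⊗ bs) y) ⟩
    U * V + (newton (as ⊗ advance v) y + newton (u ⊗ bs) y)
      ≡⟨ cong₂ (λ s t → U * V + (s + t)) (trans (newton-⊗ as (advance v) y) (cong (A *_) (newton-advance v y)))
                                         (newton-⊗ u bs y) ⟩
    U * V + (A * (V + B) + U * B)
      ≡⟨ solve 4 (λ U A V B → U :* V :+ (A :* (V :+ B) :+ U :* B) := (U :+ A) :* (V :+ B)) refl U A V B ⟩
    (U + A) * (V + B) ∎
    where
    u = a ∷ as
    v = b ∷ bs
    U = newton u y
    V = newton v y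
    A = newton as y
    B = newton bs y

  NewtonExpansion-+ : ∀ {f g} → NewtonExpansion f → NewtonExpansion g → NewtonExpansion (λ y → f y + g y)
  NewtonExpansion-+ (as , f≗) (bs , g≗) = as ⊕ bs , λ y → trans (cong₂ _+_ (f≗ y) (g≗ y)) (sym (newton-⊕ as bs y))

  NewtonExpansion-* : ∀ {f g} → NewtonExpansion f → NewtonExpansion g → NewtonExpansion (λ y → f y * g y)
  NewtonExpansion-* (as , f≗) (bs , g≗) = as ⊗ bs , λ y → trans (cong₂ _*_ (f≗ y) (g≗ y)) (sym (newton-⊗ as bs y))

  NewtonExpansion-C : ∀ r s → NewtonExpansion (λ y → (y + r) C s)
  NewtonExpansion-C r zero    = 1 ∷ [] , newton-difference _ 1 [] refl (λ _ → refl)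
  NewtonExpansion-C r (suc s) with NewtonExpansion-C r s
  ... | ds , ds≗ = r C suc s ∷ ds , newton-difference _ (r C suc s) ds refl λ y → begin
    suc (y + r) C suc s                      ≡⟨ nCk+nC[k+1]≡[n+1]C[k+1] (y + r) s ⟨
    (y + r) C s + (y + r) C suc s            ≡⟨ +-comm ((y + r) C s) _ ⟩
    (y + r) C suc s + (y + r) C s            ≡⟨ cong ((y + r) C suc s +_) (ds≗ y) ⟩
    (y + r) C suc s + newton ds y            ∎

module BinomialProducts where

  open import Data.Nat
  open import Data.Nat.Properties
  open import Data.Nat.Combinatorics using (_C_)
  open import Data.Nat.Solver using (module +-*-Solver)
  open import Data.List using (List; []; _∷_; map)
  open import Data.Product using (_,_)
  open import Relation.Binary.PropositionalEquality
  open ≡-Reasoning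
  open +-*-Solver
  open BinomialIdentities
  open Newton

  binomialProduct : List ℕ → ℕ → ℕ
  binomialProduct rs y = prodℕ (map (λ s → (y + s) C s) rs)

  -- s · ((y + s) C s) / (y + 1)
  C-quotient : ℕ → ℕ → ℕ
  C-quotient zero    y = 0
  C-quotient (suc s) y = (y + suc s) C s

  -- |rs| · binomialProduct rs y / (y + 1), expanded by the product rule.
  binomialQuotient : List ℕ → ℕ → ℕ
  binomialQuotient []       y = 0
  binomialQuotient (s ∷ rs) y = C-quotient s y * binomialProduct rs y + ((y + s) C s) * binomialQuotient rs y

  suc*C-quotient : ∀ s y → suc y * C-quotient s y ≡ s * ((y + s) C s)
  suc*C-quotient zero    y = *-zeroʳ (suc y)
  suc*C-quotient (suc s) y = suc*C≡suc*C-suc y s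

  suc*binomialQuotient : ∀ rs y → suc y * binomialQuotient rs y ≡ sumℕ rs * binomialProduct rs y
  suc*binomialQuotient []       y = *-zeroʳ (suc y)
  suc*binomialQuotient (s ∷ rs) y = begin
    suc y * (q * P + c * Q)
      ≡⟨ solve 5 (λ Y q P c Q → Y :* (q :* P :+ c :* Q) := (Y :* q) :* P :+ c :* (Y :* Q)) refl (suc y) q P c Q ⟩
    (suc y * q) * P + c * (suc y * Q)
      ≡⟨ cong₂ (λ u v → u * P + c * v) (suc*C-quotient s y) (suc*binomialQuotient rs y) ⟩
    (s * c) * P + c * (sumℕ rs * P)
      ≡⟨ solve 4 (λ s c P S → (s :* c) :* P :+ c :* (S :* P) := (s :+ S) :* (c :* P)) refl s c P (sumℕ rs) ⟩
    (s + sumℕ rs) * (c * P) ∎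
    where
    q = C-quotient s y
    c = (y + s) C s
    P = binomialProduct rs y
    Q = binomialQuotient rs y

  NewtonExpansion-binomialProduct : ∀ rs → NewtonExpansion (binomialProduct rs)
  NewtonExpansion-binomialProduct []       = 1 ∷ [] , newton-difference _ 1 [] refl (λ _ → refl)
  NewtonExpansion-binomialProduct (s ∷ rs) = NewtonExpansion-* (NewtonExpansion-C s s) (NewtonExpansion-binomialProduct rs)

  NewtonExpansion-binomialQuotient : ∀ rs → NewtonExpansion (binomialQuotient rs)
  NewtonExpansion-binomialQuotient []       = [] , λ _ → refl
  NewtonExpansion-binomialQuotient (s ∷ rs) = NewtonExpansion-+
    (NewtonExpansion-* (C-quotient-expansion s) (NewtonExpansion-binomialProduct rs))
    (NewtonExpansion-* (NewtonExpansion-C s s) (NewtonExpansion-binomialQuotient rs))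
    where
    C-quotient-expansion : ∀ s → NewtonExpansion (C-quotient s)
    C-quotient-expansion zero    = [] , λ _ → refl
    C-quotient-expansion (suc s) = NewtonExpansion-C (suc s) s

module Partitions where

  open import Data.Nat
  open import Data.Nat.Properties
  open import Data.Bool using (T; true; false)
  open import Data.Bool.Properties using (T-∧)
  open import Data.Nat.ListAction.Properties using (product-++; product≢0)
  open import Data.Product using (Σ-syntax; _×_; _,_; proj₁)
  open import Data.Sum using (inj₁; inj₂)
  open import Data.Empty using (⊥-elim)
  open import Data.List using (List; []; _∷_; map; upTo; _++_; concatMap; length; replicate)
  import Data.List.Properties as List
  open import Data.List.Membership.Propositional using (_∈_; find; lose)
  open import Data.List.Membership.Propositional.Properties
    using (∈-concatMap⁻; ∈-concatMap⁺; ∈-map⁻; ∈-map⁺; ∈-upTo⁺; ∈-upTo⁻; ∈-filter⁻; ∈-filter⁺)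
  open import Data.List.Membership.Propositional.Properties.WithK using (unique∧set⇒bag)
  open import Data.List.Relation.Unary.All as All using (All; []; _∷_)
  import Data.List.Relation.Unary.All.Properties as AllP
  open import Data.List.Relation.Unary.Any using (here)
  open import Data.List.Relation.Unary.AllPairs using ([]; _∷_)
  open import Data.List.Relation.Unary.Unique.Propositional using (Unique)
  import Data.List.Relation.Unary.Unique.Propositional.Properties as Unique
  open import Data.List.Relation.Binary.Permutation.Propositional using (_↭_)
  open import Data.List.Relation.Binary.BagAndSetEquality using (∼bag⇒↭)
  open import Function using (_∘_)
  open import Function.Bundles using (mk⇔; Equivalence)
  open import Relation.Nullary using (¬_; yes; no)
  open import Relation.Nullary.Decidable using (T?)
  open import Relation.Binary.PropositionalEquality

  data Parts≤ : ℕ → List ℕ → Set where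
    []   : ∀ {b} → Parts≤ b []
    cons : ∀ {b a μ} → 1 ≤ a → a ≤ b → Parts≤ a μ → Parts≤ b (a ∷ μ)

  Parts≤-weaken : ∀ {b c μ} → b ≤ c → Parts≤ b μ → Parts≤ c μ
  Parts≤-weaken b≤c []                 = []
  Parts≤-weaken b≤c (cons 1≤a a≤b μ≤a) = cons 1≤a (≤-trans a≤b b≤c) μ≤a

  Parts≤-sum : ∀ {b μ} → Parts≤ b μ → Parts≤ (sumℕ μ) μ
  Parts≤-sum []               = []
  Parts≤-sum (cons 1≤a _ μ≤a) = cons 1≤a (m≤m+n _ _) μ≤a

  length≤sum : ∀ {b μ} → Parts≤ b μ → length μ ≤ sumℕ μ
  length≤sum []               = z≤n
  length≤sum (cons 1≤a _ μ≤a) = +-mono-≤ 1≤a (length≤sum μ≤a)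

  All-positive : ∀ {b μ} → Parts≤ b μ → All (1 ≤_) μ
  All-positive []               = []
  All-positive (cons 1≤a _ μ≤a) = 1≤a ∷ All-positive μ≤a

  Parts≤-block : ∀ {b ν} m → Parts≤ b ν → Parts≤ (suc b) (replicate m (suc b) ++ ν)
  Parts≤-block zero    ν≤b = Parts≤-weaken (n≤1+n _) ν≤b
  Parts≤-block (suc m) ν≤b = cons (s≤s z≤n) ≤-refl (Parts≤-block m ν≤b)

  sum-block : ∀ m p ν → sumℕ (replicate m p ++ ν) ≡ m * p + sumℕ ν
  sum-block zero    p ν = refl
  sum-block (suc m) p ν = trans (cong (p +_) (sum-block m p ν)) (sym (+-assoc p (m * p) _))

  split-block : ∀ {b μ} → Parts≤ (suc b) μ → Σ[ m ∈ ℕ ] Σ[ ν ∈ List ℕ ] μ ≡ replicate m (suc b) ++ ν × Parts≤ b ν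
  split-block [] = 0 , [] , refl , []
  split-block (cons 1≤a a≤1+b μ≤a) with m≤n⇒m<n∨m≡n a≤1+b
  ... | inj₁ (s≤s a≤b) = 0 , _ , refl , cons 1≤a a≤b μ≤a
  ... | inj₂ refl with split-block μ≤a
  ...   | m , ν , refl , ν≤b = suc m , ν , refl , ν≤b

  block-injective : ∀ {b} m m′ {ν ν′} → Parts≤ b ν → Parts≤ b ν′ →
                    replicate m (suc b) ++ ν ≡ replicate m′ (suc b) ++ ν′ → m ≡ m′
  block-injective zero    zero     _              _              eq = refl
  block-injective (suc m) (suc m′) ν≤b            ν′≤b           eq =
    cong suc (block-injective m m′ ν≤b ν′≤b (List.∷-injectiveʳ eq))
  block-injective zero    (suc m′) (cons _ a≤b _) _              eq = ⊥-elim (<-irrefl (List.∷-injectiveˡ eq) (s≤s a≤b))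
  block-injective (suc m) zero     _              (cons _ a≤b _) eq = ⊥-elim (<-irrefl (sym (List.∷-injectiveˡ eq)) (s≤s a≤b))

  Unique-concatMap : ∀ {A B : Set} (f : A → List B) {xs} → Unique xs → (∀ x → Unique (f x)) →
                     (∀ {x x′ y} → y ∈ f x → y ∈ f x′ → x ≡ x′) → Unique (concatMap f xs)
  Unique-concatMap f {[]}     []          f! disjoint = []
  Unique-concatMap f {x ∷ xs} (x∉ ∷ xs!) f! disjoint = Unique.++⁺ (f! x) (Unique-concatMap f xs! f! disjoint) apart
    where
    apart : ∀ {y} → ¬ (y ∈ f x × y ∈ concatMap f xs)
    apart (y∈fx , y∈rest) with find (∈-concatMap⁻ f {xs = xs} y∈rest)
    ... | x′ , x′∈xs , y∈fx′ = All.lookup x∉ x′∈xs (disjoint y∈fx y∈fx′)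

  block : ℕ → (ℕ → List (List ℕ)) → ℕ → ℕ → List (List ℕ)
  block p below n m with m * p ≤? n
  ... | yes _ = map (replicate m p ++_) (below (n ∸ m * p))
  ... | no  _ = []

  partitions≤ : ℕ → ℕ → List (List ℕ)
  partitions≤ zero    zero    = [] ∷ []
  partitions≤ zero    (suc n) = []
  partitions≤ (suc b) n       = concatMap (block (suc b) (partitions≤ b) n) (upTo (suc n))

  ∈-block⁻ : ∀ {p below n m μ} → μ ∈ block p below n m →
             m * p ≤ n × Σ[ ν ∈ List ℕ ] ν ∈ below (n ∸ m * p) × μ ≡ replicate m p ++ ν
  ∈-block⁻ {p} {below} {n} {m} μ∈ with m * p ≤? n
  ∈-block⁻ μ∈ | yes mp≤n with ∈-map⁻ _ μ∈
  ... | ν , ν∈ , refl = mp≤n , ν , ν∈ , refl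
  ∈-block⁻ () | no _

  ∈-block⁺ : ∀ {p below n m ν} → m * p ≤ n → ν ∈ below (n ∸ m * p) → replicate m p ++ ν ∈ block p below n m
  ∈-block⁺ {p} {below} {n} {m} mp≤n ν∈ with m * p ≤? n
  ... | yes _    = ∈-map⁺ _ ν∈
  ... | no mp≰n = ⊥-elim (mp≰n mp≤n)

  partitions≤-sound : ∀ b n {μ} → μ ∈ partitions≤ b n → Parts≤ b μ × sumℕ μ ≡ n
  partitions≤-sound zero    zero    (here refl) = [] , refl
  partitions≤-sound (suc b) n       μ∈ with find (∈-concatMap⁻ (block (suc b) (partitions≤ b) n) {xs = upTo (suc n)} μ∈)
  ... | m , _ , μ∈block with ∈-block⁻ {suc b} {partitions≤ b} {n} {m} μ∈block
  ...   | mp≤n , ν , ν∈ , refl with partitions≤-sound b (n ∸ m * suc b) ν∈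
  ...     | ν≤b , sumν = Parts≤-block m ν≤b , (begin
    sumℕ (replicate m (suc b) ++ ν)    ≡⟨ sum-block m (suc b) ν ⟩
    m * suc b + sumℕ ν                ≡⟨ cong (m * suc b +_) sumν ⟩
    m * suc b + (n ∸ m * suc b)       ≡⟨ m+[n∸m]≡n mp≤n ⟩
    n                                 ∎)
    where open ≡-Reasoning

  partitions≤-complete : ∀ b n {μ} → Parts≤ b μ → sumℕ μ ≡ n → μ ∈ partitions≤ b n
  partitions≤-complete zero    n []                 refl = here refl
  partitions≤-complete zero    n (cons 1≤a a≤0 _)   _    = ⊥-elim (<⇒≱ 1≤a a≤0)
  partitions≤-complete (suc b) n μ≤p                sumμ with split-block μ≤p
  ... | m , ν , refl , ν≤b =
    ∈-concatMap⁺ (block (suc b) (partitions≤ b) n) {xs = upTo (suc n)}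
      (lose (∈-upTo⁺ (s≤s (≤-trans (m≤m*n m (suc b)) mp≤n)))
            (∈-block⁺ mp≤n (partitions≤-complete b _ ν≤b sumν)))
    where
    total : m * suc b + sumℕ ν ≡ n
    total = trans (sym (sum-block m (suc b) ν)) sumμ
    mp≤n : m * suc b ≤ n
    mp≤n = subst (m * suc b ≤_) total (m≤m+n _ _)
    sumν : sumℕ ν ≡ n ∸ m * suc b
    sumν = sym (trans (cong (_∸ m * suc b) (sym total)) (m+n∸m≡n (m * suc b) (sumℕ ν)))

  partitions≤-unique : ∀ b n → Unique (partitions≤ b n)
  partitions≤-unique zero    zero    = [] ∷ []
  partitions≤-unique zero    (suc n) = []
  partitions≤-unique (suc b) n       = Unique-concatMap (block (suc b) (partitions≤ b) n) (Unique.upTo⁺ (suc n)) block-unique disjoint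
    where
    block-unique : ∀ m → Unique (block (suc b) (partitions≤ b) n m)
    block-unique m with m * suc b ≤? n
    ... | yes _ = Unique.map⁺ (List.++-cancelˡ (replicate m (suc b)) _ _) (partitions≤-unique b _)
    ... | no  _ = []
    disjoint : ∀ {m m′ μ} → μ ∈ block (suc b) (partitions≤ b) n m → μ ∈ block (suc b) (partitions≤ b) n m′ → m ≡ m′
    disjoint {m} {m′} μ∈ μ∈′
      with ∈-block⁻ {suc b} {partitions≤ b} {n} {m} μ∈ | ∈-block⁻ {suc b} {partitions≤ b} {n} {m′} μ∈′
    ... | _ , ν , ν∈ , refl | _ , ν′ , ν′∈ , eq =
      block-injective m m′ (proj₁ (partitions≤-sound b _ ν∈)) (proj₁ (partitions≤-sound b _ ν′∈)) eq

  listsOf-length : ∀ l n {μ} → μ ∈ listsOf l n → length μ ≡ l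
  listsOf-length zero    n (here refl) = refl
  listsOf-length (suc l) n μ∈ with find (∈-concatMap⁻ (λ a → map (a ∷_) (listsOf l n)) {xs = map suc (upTo n)} μ∈)
  ... | a , _ , μ∈a with ∈-map⁻ (a ∷_) μ∈a
  ...   | ν , ν∈ , refl = cong suc (listsOf-length l n ν∈)

  listsOf-bounded : ∀ l n {μ} → μ ∈ listsOf l n → All (λ a → 1 ≤ a × a ≤ n) μ
  listsOf-bounded zero    n (here refl) = []
  listsOf-bounded (suc l) n μ∈ with find (∈-concatMap⁻ (λ a → map (a ∷_) (listsOf l n)) {xs = map suc (upTo n)} μ∈)
  ... | a , a∈ , μ∈a with ∈-map⁻ (a ∷_) μ∈a | ∈-map⁻ suc a∈
  ...   | ν , ν∈ , refl | a′ , a′∈ , refl = (s≤s z≤n , ∈-upTo⁻ a′∈) ∷ listsOf-bounded l n ν∈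

  listsOf-unique : ∀ l n → Unique (listsOf l n)
  listsOf-unique zero    n = [] ∷ []
  listsOf-unique (suc l) n = Unique-concatMap (λ a → map (a ∷_) (listsOf l n))
    (Unique.map⁺ suc-injective (Unique.upTo⁺ n)) (λ a → Unique.map⁺ List.∷-injectiveʳ (listsOf-unique l n)) disjoint
    where
    disjoint : ∀ {a a′ μ} → μ ∈ map (a ∷_) (listsOf l n) → μ ∈ map (a′ ∷_) (listsOf l n) → a ≡ a′
    disjoint {a} {a′} μ∈ μ∈′ with ∈-map⁻ (a ∷_) μ∈ | ∈-map⁻ (a′ ∷_) μ∈′
    ... | _ , _ , refl | _ , _ , eq = List.∷-injectiveˡ eq

  listsOf-complete : ∀ {n μ} → Parts≤ n μ → μ ∈ listsOf (length μ) n
  listsOf-complete []                           = here refl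
  listsOf-complete {n} (cons {a = suc a} {μ} _ a<n μ≤a) =
    ∈-concatMap⁺ (λ a → map (a ∷_) (listsOf (length μ) n)) {xs = map suc (upTo n)}
      (lose (∈-map⁺ suc (∈-upTo⁺ a<n)) (∈-map⁺ (suc a ∷_) (listsOf-complete (Parts≤-weaken a<n μ≤a))))

  Parts≤⇒nonincreasing : ∀ {b μ} → Parts≤ b μ → T (nonincreasing μ)
  Parts≤⇒nonincreasing []                              = _
  Parts≤⇒nonincreasing (cons _ _ [])                   = _
  Parts≤⇒nonincreasing (cons _ _ μ≤a@(cons _ c≤a _))   = Equivalence.from T-∧ (≤⇒≤ᵇ c≤a , Parts≤⇒nonincreasing μ≤a)

  nonincreasing⇒Parts≤ : ∀ {a b μ} → 1 ≤ a → a ≤ b → All (1 ≤_) μ → T (nonincreasing (a ∷ μ)) → Parts≤ b (a ∷ μ)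
  nonincreasing⇒Parts≤ 1≤a a≤b []          _ = cons 1≤a a≤b []
  nonincreasing⇒Parts≤ {a} {μ = c ∷ μ} 1≤a a≤b (1≤c ∷ pos) t with Equivalence.to T-∧ t
  ... | c≤a , t′ = cons 1≤a a≤b (nonincreasing⇒Parts≤ 1≤c (≤ᵇ⇒≤ c a c≤a) pos t′)

  partitions-sound : ∀ n {μ} → μ ∈ partitions n → Parts≤ n μ × sumℕ μ ≡ n
  partitions-sound n {μ} μ∈ with ∈-filter⁻ (λ μ → T? (isPartitionOf n μ)) {xs = concatMap (λ l → listsOf l n) (upTo (suc n))} μ∈
  ... | μ∈lists , isPartition with find (∈-concatMap⁻ (λ l → listsOf l n) {xs = upTo (suc n)} μ∈lists) | Equivalence.to T-∧ isPartition
  ...   | l , _ , μ∈l | noninc , sum≡ = Parts≤-from μ (listsOf-bounded l n μ∈l) noninc , ≡ᵇ⇒≡ (sumℕ μ) n sum≡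
    where
    Parts≤-from : ∀ μ → All (λ a → 1 ≤ a × a ≤ n) μ → T (nonincreasing μ) → Parts≤ n μ
    Parts≤-from []      _                     _      = []
    Parts≤-from (a ∷ μ) ((1≤a , a≤n) ∷ bounded) noninc = nonincreasing⇒Parts≤ 1≤a a≤n (All.map proj₁ bounded) noninc

  partitions-complete : ∀ n {μ} → Parts≤ n μ → sumℕ μ ≡ n → μ ∈ partitions n
  partitions-complete n {μ} μ≤n sumμ =
    ∈-filter⁺ (λ μ → T? (isPartitionOf n μ)) {xs = concatMap (λ l → listsOf l n) (upTo (suc n))}
      (∈-concatMap⁺ (λ l → listsOf l n) {xs = upTo (suc n)} (lose (∈-upTo⁺ length<1+n) (listsOf-complete μ≤n)))
      (Equivalence.from T-∧ (Parts≤⇒nonincreasing μ≤n , ≡⇒≡ᵇ (sumℕ μ) n sumμ))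
    where
    length<1+n : length μ < suc n
    length<1+n = s≤s (subst (length μ ≤_) sumμ (length≤sum μ≤n))

  partitions-unique : ∀ n → Unique (partitions n)
  partitions-unique n = Unique.filter⁺ (λ μ → T? (isPartitionOf n μ))
    (Unique-concatMap (λ l → listsOf l n) (Unique.upTo⁺ (suc n)) (λ l → listsOf-unique l n)
      (λ μ∈l μ∈l′ → trans (sym (listsOf-length _ n μ∈l)) (listsOf-length _ n μ∈l′)))

  partitions↭partitions≤ : ∀ n b → n ≤ b → partitions n ↭ partitions≤ b n
  partitions↭partitions≤ n b n≤b = ∼bag⇒↭ (unique∧set⇒bag (partitions-unique n) (partitions≤-unique b n) (mk⇔ to from))
    where
    to : ∀ {μ} → μ ∈ partitions n → μ ∈ partitions≤ b n
    to μ∈ with partitions-sound n μ∈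
    ... | μ≤n , sumμ = partitions≤-complete b n (Parts≤-weaken n≤b μ≤n) sumμ
    from : ∀ {μ} → μ ∈ partitions≤ b n → μ ∈ partitions n
    from μ∈ with partitions≤-sound b n μ∈
    ... | μ≤b , refl = partitions-complete _ (Parts≤-sum μ≤b) refl

  mult-∷-≡ : ∀ i μ → mult i (i ∷ μ) ≡ suc (mult i μ)
  mult-∷-≡ i μ with i ≡ᵇ i in eq
  ... | true  = refl
  ... | false = ⊥-elim (subst T eq (≡⇒≡ᵇ i i refl))

  mult-∷-≢ : ∀ a {i} μ → a ≢ i → mult i (a ∷ μ) ≡ mult i μ
  mult-∷-≢ a {i} μ a≢i with a ≡ᵇ i in eq
  ... | true  = ⊥-elim (a≢i (≡ᵇ⇒≡ a i (subst T (sym eq) _)))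
  ... | false = refl

  mult-block-≡ : ∀ m p ν → mult p (replicate m p ++ ν) ≡ m + mult p ν
  mult-block-≡ zero    p ν = refl
  mult-block-≡ (suc m) p ν = trans (mult-∷-≡ p (replicate m p ++ ν)) (cong suc (mult-block-≡ m p ν))

  mult-block-≢ : ∀ m {p i} ν → p ≢ i → mult i (replicate m p ++ ν) ≡ mult i ν
  mult-block-≢ zero    ν p≢i = refl
  mult-block-≢ (suc m) {p} ν p≢i = trans (mult-∷-≢ p (replicate m p ++ ν) p≢i) (mult-block-≢ m ν p≢i)

  mult-above : ∀ {b i μ} → Parts≤ b μ → b < i → mult i μ ≡ 0
  mult-above []                  b<i = refl
  mult-above {μ = a ∷ μ} (cons _ a≤b μ≤a) b<i =
    trans (mult-∷-≢ a μ (λ { refl → <⇒≱ b<i a≤b })) (mult-above μ≤a (≤-<-trans a≤b b<i))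

  z-factor : List ℕ → ℕ → ℕ
  z-factor μ i = i ^ mult i μ * mult i μ !

  zUpTo : ℕ → List ℕ → ℕ
  zUpTo N μ = prodℕ (map (λ i → z-factor μ (suc i)) (upTo N))

  z≡zUpTo : ∀ μ → z μ ≡ zUpTo (sumℕ μ) μ
  z≡zUpTo μ = cong prodℕ (sym (List.map-∘ (upTo (sumℕ μ))))

  zUpTo-suc : ∀ N μ → zUpTo (suc N) μ ≡ zUpTo N μ * z-factor μ (suc N)
  zUpTo-suc N μ = begin
    prodℕ (map f (upTo (suc N)))               ≡⟨ cong (prodℕ ∘ map f) (List.upTo-∷ʳ N) ⟨
    prodℕ (map f (upTo N ++ N ∷ []))           ≡⟨ cong prodℕ (List.map-++ f (upTo N) (N ∷ [])) ⟩
    prodℕ (map f (upTo N) ++ f N ∷ [])         ≡⟨ product-++ (map f (upTo N)) (f N ∷ []) ⟩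
    zUpTo N μ * (f N * 1)                      ≡⟨ cong (zUpTo N μ *_) (*-identityʳ (f N)) ⟩
    zUpTo N μ * f N                            ∎
    where
    open ≡-Reasoning
    f = λ i → z-factor μ (suc i)

  zUpTo-cong : ∀ N {μ ν} → (∀ {i} → i < N → z-factor μ (suc i) ≡ z-factor ν (suc i)) → zUpTo N μ ≡ zUpTo N ν
  zUpTo-cong zero    μ≗ν = refl
  zUpTo-cong (suc N) {μ} {ν} μ≗ν = begin
    zUpTo (suc N) μ
      ≡⟨ zUpTo-suc N μ ⟩
    zUpTo N μ * z-factor μ (suc N)
      ≡⟨ cong₂ _*_ (zUpTo-cong N {μ} {ν} (λ i<N → μ≗ν (m<n⇒m<1+n i<N))) (μ≗ν ≤-refl) ⟩
    zUpTo N ν * z-factor ν (suc N)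
      ≡⟨ zUpTo-suc N ν ⟨
    zUpTo (suc N) ν ∎
    where open ≡-Reasoning

  zUpTo-stable : ∀ {c μ} N → Parts≤ c μ → c ≤ N → zUpTo N μ ≡ zUpTo c μ
  zUpTo-stable {c} {μ} N μ≤c c≤N = trans (cong (λ N → zUpTo N μ) (sym (m+[n∸m]≡n c≤N))) (beyond (N ∸ c))
    where
    open ≡-Reasoning
    beyond : ∀ k → zUpTo (c + k) μ ≡ zUpTo c μ
    beyond zero    = cong (λ N → zUpTo N μ) (+-identityʳ c)
    beyond (suc k) = begin
      zUpTo (c + suc k) μ
        ≡⟨ cong (λ N → zUpTo N μ) (+-suc c k) ⟩
      zUpTo (suc (c + k)) μ
        ≡⟨ zUpTo-suc (c + k) μ ⟩
      zUpTo (c + k) μ * z-factor μ (suc (c + k))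
        ≡⟨ cong₂ _*_ (beyond k) (cong (λ e → suc (c + k) ^ e * e !) (mult-above μ≤c (s≤s (m≤m+n c k)))) ⟩
      zUpTo c μ * 1
        ≡⟨ *-identityʳ (zUpTo c μ) ⟩
      zUpTo c μ ∎

  z-block : ∀ {b ν} m → Parts≤ b ν → z (replicate m (suc b) ++ ν) ≡ (suc b ^ m * m !) * z ν
  z-block {b} {ν} zero    ν≤b = sym (*-identityˡ (z ν))
  z-block {b} {ν} (suc m) ν≤b = begin
    z μ                                      ≡⟨ z≡zUpTo μ ⟩
    zUpTo (sumℕ μ) μ                         ≡⟨ zUpTo-stable (sumℕ μ) (Parts≤-block (suc m) ν≤b) p≤sumμ ⟩
    zUpTo (suc b) μ                          ≡⟨ zUpTo-suc b μ ⟩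
    zUpTo b μ * z-factor μ (suc b)           ≡⟨ cong₂ _*_ (zUpTo-cong b {μ} {ν} below-p) at-p ⟩
    zUpTo b ν * (p ^ suc m * suc m !)        ≡⟨ *-comm (zUpTo b ν) (p ^ suc m * suc m !) ⟩
    (p ^ suc m * suc m !) * zUpTo b ν        ≡⟨ cong ((p ^ suc m * suc m !) *_) z-ν ⟨
    (p ^ suc m * suc m !) * z ν              ∎
    where
    open ≡-Reasoning
    p = suc b
    μ = replicate (suc m) p ++ ν
    p≤sumμ : p ≤ sumℕ μ
    p≤sumμ = subst (p ≤_) (sym (sum-block (suc m) p ν)) (≤-trans (m≤m+n p (m * p)) (m≤m+n _ (sumℕ ν)))
    below-p : ∀ {i} → i < b → z-factor μ (suc i) ≡ z-factor ν (suc i)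
    below-p i<b = cong (λ e → _ ^ e * e !) (mult-block-≢ (suc m) ν (λ p≡ → <-irrefl (sym (suc-injective p≡)) i<b))
    at-p : z-factor μ p ≡ p ^ suc m * suc m !
    at-p = cong (λ e → p ^ e * e !)
      (trans (mult-block-≡ (suc m) p ν) (trans (cong (suc m +_) (mult-above ν≤b ≤-refl)) (+-identityʳ (suc m))))
    z-ν : z ν ≡ zUpTo b ν
    z-ν = begin
      z ν                                  ≡⟨ z≡zUpTo ν ⟩
      zUpTo (sumℕ ν) ν                     ≡⟨ zUpTo-stable (b + sumℕ ν) (Parts≤-sum ν≤b) (m≤n+m (sumℕ ν) b) ⟨
      zUpTo (b + sumℕ ν) ν                 ≡⟨ zUpTo-stable (b + sumℕ ν) ν≤b (m≤m+n b (sumℕ ν)) ⟩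
      zUpTo b ν                            ∎

  z-nonZero : ∀ μ → NonZero (z μ)
  z-nonZero μ = product≢0 (AllP.map⁺ (AllP.map⁺ (All.universal factor≢0 (upTo (sumℕ μ)))))
    where
    factor≢0 : ∀ i → NonZero (suc i ^ mult (suc i) μ * mult (suc i) μ !)
    factor≢0 i = m*n≢0 _ _ {{m^n≢0 (suc i) (mult (suc i) μ)}} {{mult (suc i) μ !≢0}}

module PartitionSums where

  open import Data.Nat as ℕ using (ℕ; zero; suc; _≤_; _<_; _∸_; _!; _^_; _≤?_; z≤n; s≤s; NonZero)
  import Data.Nat.Properties as ℕ
  open import Data.Rational using (ℚ; 0ℚ; 1ℚ; _+_; _*_)
  open import Data.Rational.Properties using (+-identityˡ; +-comm; *-zeroˡ; *-zeroʳ; *-identityˡ; *-identityʳ; *-assoc; *-comm)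
  open import Data.Rational.Solver using (module +-*-Solver)
  open import Algebra.Properties.CommutativeSemigroup ℕ.*-commutativeSemigroup using (interchange)
  open import Data.List using (List; []; _∷_; map; upTo; _++_; replicate; length)
  import Data.List.Properties as List
  open import Data.Nat.Induction using (<-rec)
  open import Data.Product using (proj₁; proj₂)
  open import Data.List.Relation.Unary.All using (All; []; _∷_)
  open import Relation.Nullary using (yes; no; contradiction)
  open import Relation.Binary.PropositionalEquality
  open ≡-Reasoning
  open +-*-Solver
  open Cast
  open Sums
  open Binomial using (multichoose; multichoose-absorb; multichoose-hockey)
  open Partitions

  guard : ℕ → ℕ → ℚ → ℚ
  guard s n x with s ≤? n
  ... | yes _ = x
  ... | no  _ = 0ℚ

  guard-yes : ∀ {s n} x → s ≤ n → guard s n x ≡ x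
  guard-yes {s} {n} x s≤n with s ≤? n
  ... | yes _   = refl
  ... | no s≰n = contradiction s≤n s≰n

  guard-no : ∀ {s n} x → n < s → guard s n x ≡ 0ℚ
  guard-no {s} {n} x n<s with s ≤? n
  ... | yes s≤n = contradiction s≤n (ℕ.<⇒≱ n<s)
  ... | no _    = refl

  guard-cong : ∀ {s n x y} → (s ≤ n → x ≡ y) → guard s n x ≡ guard s n y
  guard-cong {s} {n} x≡y with s ≤? n
  ... | yes s≤n = x≡y s≤n
  ... | no  _   = refl

  guard-⇔ : ∀ {s n s′ n′} x → (s ≤ n → s′ ≤ n′) → (s′ ≤ n′ → s ≤ n) → guard s n x ≡ guard s′ n′ x
  guard-⇔ {s} {n} {s′} {n′} x to from with s ≤? n | s′ ≤? n′
  ... | yes _   | yes _    = refl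
  ... | yes s≤n | no s′≰n′ = contradiction (to s≤n) s′≰n′
  ... | no s≰n  | yes s′≤n′ = contradiction (from s′≤n′) s≰n
  ... | no _    | no _     = refl

  guard-0 : ∀ s n → guard s n 0ℚ ≡ 0ℚ
  guard-0 s n with s ≤? n
  ... | yes _ = refl
  ... | no  _ = refl

  guard-+ : ∀ s n x y → guard s n (x + y) ≡ guard s n x + guard s n y
  guard-+ s n x y with s ≤? n
  ... | yes _ = refl
  ... | no  _ = refl

  guard-*ˡ : ∀ c s n x → c * guard s n x ≡ guard s n (c * x)
  guard-*ˡ c s n x with s ≤? n
  ... | yes _ = refl
  ... | no  _ = *-zeroʳ c

  guard-∑ : ∀ s n K f → ∑[ m < K ] guard s n (f m) ≡ guard s n (∑< K f)
  guard-∑ s n K f with s ≤? n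
  ... | yes _ = refl
  ... | no  _ = ∑<-zero K (λ _ → refl)

  guard-shift : ∀ a c n x → guard (a ℕ.+ c) n x ≡ guard a n (guard c (n ∸ a) x)
  guard-shift a c n x with a ≤? n
  ... | yes a≤n = guard-⇔ x (λ a+c≤n → ℕ.m+n≤o⇒m≤o∸n c (subst (_≤ n) (ℕ.+-comm a c) a+c≤n))
                            (λ c≤n∸a → subst (_≤ n) (ℕ.+-comm c a) (ℕ.m≤o∸n⇒m+n≤o c a≤n c≤n∸a))
  ... | no a≰n  = guard-no x (ℕ.<-≤-trans (ℕ.≰⇒> a≰n) (ℕ.m≤m+n a c))

  guard-comm : ∀ a c n x → guard a n (guard c (n ∸ a) x) ≡ guard c n (guard a (n ∸ c) x)
  guard-comm a c n x = begin
    guard a n (guard c (n ∸ a) x)        ≡⟨ guard-shift a c n x ⟨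
    guard (a ℕ.+ c) n x                  ≡⟨ cong (λ s → guard s n x) (ℕ.+-comm a c) ⟩
    guard (c ℕ.+ a) n x                  ≡⟨ guard-shift c a n x ⟩
    guard c n (guard a (n ∸ c) x)        ∎

  ^ℚ-+ : ∀ X m l → X ^ℚ (m ℕ.+ l) ≡ X ^ℚ m * X ^ℚ l
  ^ℚ-+ X zero    l = sym (*-identityˡ _)
  ^ℚ-+ X (suc m) l = trans (cong (X *_) (^ℚ-+ X m l)) (sym (*-assoc X _ _))

  length-block : ∀ m (p : ℕ) ν → length (replicate m p ++ ν) ≡ m ℕ.+ length ν
  length-block m p ν = trans (List.length-++ (replicate m p)) (cong (ℕ._+ length ν) (List.length-replicate m))

  ω : List ℕ → ℚ
  ω μ = inv (z μ)

  blockWeight : ℕ → ℕ → ℚ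
  blockWeight p m = inv (p ^ m ℕ.* m !)

  ω-block : ∀ {b ν} m → Parts≤ b ν → ω (replicate m (suc b) ++ ν) ≡ blockWeight (suc b) m * ω ν
  ω-block {b} {ν} m ν≤b = trans (cong inv (z-block m ν≤b))
    (inv-* (suc b ^ m ℕ.* m !) (z ν) {{ℕ.m*n≢0 _ _ {{ℕ.m^n≢0 (suc b) m}} {{m ℕ.!≢0}}}} {{z-nonZero ν}})

  blockWeight-suc : ∀ p m → .{{_ : NonZero p}} → blockWeight p (suc m) * ℕ→ℚ (suc m ℕ.* p) ≡ blockWeight p m
  blockWeight-suc p m = begin
    inv (p ^ suc m ℕ.* suc m !) * ℕ→ℚ a
      ≡⟨ cong (λ t → inv t * ℕ→ℚ a) reorder ⟩
    inv (a ℕ.* c) * ℕ→ℚ a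
      ≡⟨ cong (_* ℕ→ℚ a) (inv-* a c {{ℕ.m*n≢0 (suc m) p}} {{c≢0}}) ⟩
    (inv a * inv c) * ℕ→ℚ a
      ≡⟨ solve 3 (λ x y z → (x :* y) :* z := (x :* z) :* y) refl (inv a) (inv c) (ℕ→ℚ a) ⟩
    (inv a * ℕ→ℚ a) * inv c
      ≡⟨ cong (_* inv c) (inv*ℕ→ℚ a {{ℕ.m*n≢0 (suc m) p}}) ⟩
    1ℚ * inv c
      ≡⟨ *-identityˡ (inv c) ⟩
    inv c ∎
    where
    a = suc m ℕ.* p
    c = p ^ m ℕ.* m !
    c≢0 : NonZero c
    c≢0 = ℕ.m*n≢0 _ _ {{ℕ.m^n≢0 p m}} {{m ℕ.!≢0}}
    reorder : p ^ suc m ℕ.* suc m ! ≡ a ℕ.* c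
    reorder = trans (interchange p (p ^ m) (suc m) (m !)) (cong (ℕ._* c) (ℕ.*-comm p (suc m)))

  ∑-partitions≤-suc : ∀ b n (f : List ℕ → ℚ) → sumℚ (map f (partitions≤ (suc b) n)) ≡
    ∑[ m < suc n ] guard (m ℕ.* suc b) n (sumℚ (map (λ ν → f (replicate m (suc b) ++ ν)) (partitions≤ b (n ∸ m ℕ.* suc b))))
  ∑-partitions≤-suc b n f = trans (sumℚ-concatMap f (block (suc b) (partitions≤ b) n) (upTo (suc n))) (∑<-cong (suc n) per-block)
    where
    per-block : ∀ {m} → m < suc n → sumℚ (map f (block (suc b) (partitions≤ b) n m)) ≡
                guard (m ℕ.* suc b) n (sumℚ (map (λ ν → f (replicate m (suc b) ++ ν)) (partitions≤ b (n ∸ m ℕ.* suc b))))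
    per-block {m} _ with m ℕ.* suc b ≤? n
    ... | yes _ = cong sumℚ (sym (List.map-∘ (partitions≤ b (n ∸ m ℕ.* suc b))))
    ... | no  _ = refl

  module _ (X : ℚ) where

    -- Σ_{ν ⊢ N} X^{l(ν)} / z_ν, the cycle index of the symmetric group S_N at p₁ = p₂ = ⋯ = X.
    cycleIndex : ℕ → ℚ
    cycleIndex N = sumℚ (map (λ ν → ω ν * X ^ℚ length ν) (partitions N))

    cycleIndex≤ : ℕ → ℕ → ℚ
    cycleIndex≤ b N = sumℚ (map (λ ν → ω ν * X ^ℚ length ν) (partitions≤ b N))

    blockTerm : ℕ → (ℕ → ℚ) → ℕ → ℕ → ℚ
    blockTerm p G n m = guard (m ℕ.* p) n (blockWeight p m * (X ^ℚ m * G (n ∸ m ℕ.* p)))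

    blockSum : ℕ → (ℕ → ℚ) → ℕ → ℚ
    blockSum p G n = ∑< (suc n) (blockTerm p G n)

    blockSum-cong : ∀ p {G G′} n → (∀ N → G N ≡ G′ N) → blockSum p G n ≡ blockSum p G′ n
    blockSum-cong p n G≗G′ = ∑<-cong (suc n) λ {m} _ →
      cong (λ g → guard (m ℕ.* p) n (blockWeight p m * (X ^ℚ m * g))) (G≗G′ (n ∸ m ℕ.* p))

    blockSum-range : ∀ p G n K → .{{_ : NonZero p}} → n < K → ∑< K (blockTerm p G n) ≡ blockSum p G n
    blockSum-range p G n K n<K = ∑<-extend (suc n) K (blockTerm p G n) n<K
      λ {m} n<m → guard-no _ (ℕ.<-≤-trans n<m (ℕ.m≤m*n m p))

    cycleIndex≤-suc : ∀ b n → cycleIndex≤ (suc b) n ≡ blockSum (suc b) (cycleIndex≤ b) n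
    cycleIndex≤-suc b n = trans (∑-partitions≤-suc b n (λ ν → ω ν * X ^ℚ length ν))
                                (∑<-cong (suc n) λ {m} _ → cong (guard (m ℕ.* p) n) (blocks m))
      where
      p = suc b
      blocks : ∀ m → sumℚ (map (λ ν → ω (replicate m p ++ ν) * X ^ℚ length (replicate m p ++ ν)) (partitions≤ b (n ∸ m ℕ.* p)))
                     ≡ blockWeight p m * (X ^ℚ m * cycleIndex≤ b (n ∸ m ℕ.* p))
      blocks m = begin
        sumℚ (map (λ ν → ω (replicate m p ++ ν) * X ^ℚ length (replicate m p ++ ν)) νs)
          ≡⟨ sumℚ-cong νs (λ {ν} ν∈ → factor ν (proj₁ (partitions≤-sound b _ ν∈))) ⟩
        sumℚ (map (λ ν → (blockWeight p m * X ^ℚ m) * (ω ν * X ^ℚ length ν)) νs)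
          ≡⟨ sumℚ-*ˡ (blockWeight p m * X ^ℚ m) (λ ν → ω ν * X ^ℚ length ν) νs ⟩
        (blockWeight p m * X ^ℚ m) * cycleIndex≤ b (n ∸ m ℕ.* p)
          ≡⟨ *-assoc (blockWeight p m) (X ^ℚ m) _ ⟩
        blockWeight p m * (X ^ℚ m * cycleIndex≤ b (n ∸ m ℕ.* p)) ∎
        where
        νs = partitions≤ b (n ∸ m ℕ.* p)
        factor : ∀ ν → Parts≤ b ν →
                 ω (replicate m p ++ ν) * X ^ℚ length (replicate m p ++ ν) ≡ (blockWeight p m * X ^ℚ m) * (ω ν * X ^ℚ length ν)
        factor ν ν≤b = begin
          ω (replicate m p ++ ν) * X ^ℚ length (replicate m p ++ ν)
            ≡⟨ cong₂ _*_ (ω-block m ν≤b) (trans (cong (X ^ℚ_) (length-block m p ν)) (^ℚ-+ X m (length ν))) ⟩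
          (blockWeight p m * ω ν) * (X ^ℚ m * X ^ℚ length ν)
            ≡⟨ solve 4 (λ w o x y → (w :* o) :* (x :* y) := (w :* x) :* (o :* y)) refl
                       (blockWeight p m) (ω ν) (X ^ℚ m) (X ^ℚ length ν) ⟩
          (blockWeight p m * X ^ℚ m) * (ω ν * X ^ℚ length ν) ∎

    blockSum-delay : ∀ p s G n → .{{_ : NonZero p}} →
                     blockSum p (λ N → guard s N (G (N ∸ s))) n ≡ guard s n (blockSum p G (n ∸ s))
    blockSum-delay p s G n = begin
      ∑[ m < suc n ] blockTerm p (λ N → guard s N (G (N ∸ s))) n m
        ≡⟨ ∑<-cong (suc n) (λ {m} _ → term m) ⟩
      ∑[ m < suc n ] guard s n (blockTerm p G (n ∸ s) m)
        ≡⟨ guard-∑ s n (suc n) (blockTerm p G (n ∸ s)) ⟩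
      guard s n (∑< (suc n) (blockTerm p G (n ∸ s)))
        ≡⟨ cong (guard s n) (blockSum-range p G (n ∸ s) (suc n) (s≤s (ℕ.m∸n≤m n s))) ⟩
      guard s n (blockSum p G (n ∸ s)) ∎
      where
      term : ∀ m → blockTerm p (λ N → guard s N (G (N ∸ s))) n m ≡ guard s n (blockTerm p G (n ∸ s) m)
      term m = begin
        guard (m ℕ.* p) n (w * (x * guard s (n ∸ m ℕ.* p) g))
          ≡⟨ cong (λ t → guard (m ℕ.* p) n (w * t)) (guard-*ˡ x s _ g) ⟩
        guard (m ℕ.* p) n (w * guard s (n ∸ m ℕ.* p) (x * g))
          ≡⟨ cong (guard (m ℕ.* p) n) (guard-*ˡ w s _ (x * g)) ⟩
        guard (m ℕ.* p) n (guard s (n ∸ m ℕ.* p) (w * (x * g)))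
          ≡⟨ guard-comm (m ℕ.* p) s n (w * (x * g)) ⟩
        guard s n (guard (m ℕ.* p) (n ∸ s) (w * (x * g)))
          ≡⟨ cong (λ N → guard s n (guard (m ℕ.* p) (n ∸ s) (w * (x * G N)))) (∸-comm n (m ℕ.* p) s) ⟩
        guard s n (blockTerm p G (n ∸ s) m) ∎
        where
        w = blockWeight p m
        x = X ^ℚ m
        g = G (n ∸ m ℕ.* p ∸ s)
        ∸-comm : ∀ n a c → n ∸ a ∸ c ≡ n ∸ c ∸ a
        ∸-comm n a c = trans (ℕ.∸-+-assoc n a c) (trans (cong (n ∸_) (ℕ.+-comm a c)) (sym (ℕ.∸-+-assoc n c a)))

    blockSum-∑ : ∀ p k (c : ℕ → ℚ) (H : ℕ → ℕ → ℚ) n →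
                 blockSum p (λ N → ∑[ j < k ] (c j * H j N)) n ≡ ∑[ j < k ] (c j * blockSum p (H j) n)
    blockSum-∑ p k c H n = begin
      ∑[ m < suc n ] blockTerm p (λ N → ∑[ j < k ] (c j * H j N)) n m
        ≡⟨ ∑<-cong (suc n) (λ {m} _ → term m) ⟩
      ∑[ m < suc n ] ∑[ j < k ] (c j * blockTerm p (H j) n m)
        ≡⟨ ∑<-swap (suc n) k (λ m j → c j * blockTerm p (H j) n m) ⟩
      ∑[ j < k ] ∑[ m < suc n ] (c j * blockTerm p (H j) n m)
        ≡⟨ ∑<-cong k (λ {j} _ → ∑<-*ˡ (suc n) (c j) (blockTerm p (H j) n)) ⟩
      ∑[ j < k ] (c j * blockSum p (H j) n) ∎
      where
      term : ∀ m → blockTerm p (λ N → ∑[ j < k ] (c j * H j N)) n m ≡ ∑[ j < k ] (c j * blockTerm p (H j) n m)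
      term m = begin
        guard (m ℕ.* p) n (w * (x * ∑[ j < k ] (c j * H j N)))
          ≡⟨ cong (λ t → guard (m ℕ.* p) n (w * t)) (∑<-*ˡ k x (λ j → c j * H j N)) ⟨
        guard (m ℕ.* p) n (w * ∑[ j < k ] (x * (c j * H j N)))
          ≡⟨ cong (guard (m ℕ.* p) n) (∑<-*ˡ k w (λ j → x * (c j * H j N))) ⟨
        guard (m ℕ.* p) n (∑[ j < k ] (w * (x * (c j * H j N))))
          ≡⟨ cong (guard (m ℕ.* p) n) (∑<-cong k λ {j} _ →
               solve 4 (λ w x c h → w :* (x :* (c :* h)) := c :* (w :* (x :* h))) refl w x (c j) (H j N)) ⟩
        guard (m ℕ.* p) n (∑[ j < k ] (c j * (w * (x * H j N))))
          ≡⟨ guard-∑ (m ℕ.* p) n k (λ j → c j * (w * (x * H j N))) ⟨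
        ∑[ j < k ] guard (m ℕ.* p) n (c j * (w * (x * H j N)))
          ≡⟨ ∑<-cong k (λ {j} _ → guard-*ˡ (c j) (m ℕ.* p) n _) ⟨
        ∑[ j < k ] (c j * blockTerm p (H j) n m) ∎
        where
        w = blockWeight p m
        x = X ^ℚ m
        N = n ∸ m ℕ.* p

    module _ (A : ℕ → ℚ) where

      -- For μ ≠ [], Φ μ = X^{l(μ) - 1} Σᵢ μᵢ A(μᵢ).
      Φ : List ℕ → ℚ
      Φ []      = 0ℚ
      Φ (c ∷ ν) = ℕ→ℚ c * A c * X ^ℚ length ν + X * Φ ν

      Φ-blockHead : ℕ → ℕ → List ℕ → ℚ
      Φ-blockHead p zero    ν = 0ℚ
      Φ-blockHead p (suc m) ν = ℕ→ℚ (suc m ℕ.* p) * A p * X ^ℚ (m ℕ.+ length ν)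

      Φ-block : ∀ p m ν → Φ (replicate m p ++ ν) ≡ Φ-blockHead p m ν + X ^ℚ m * Φ ν
      Φ-block p zero          ν = solve 1 (λ F → F := con 0ℚ :+ con 1ℚ :* F) refl (Φ ν)
      Φ-block p (suc zero)    ν = cong₂ (λ c t → ℕ→ℚ c * A p * X ^ℚ length ν + t)
        (sym (ℕ.*-identityˡ p)) (solve 2 (λ X F → X :* F := (X :* con 1ℚ) :* F) refl X (Φ ν))
      Φ-block p (suc (suc m)) ν = begin
        P * a * X ^ℚ length (replicate (suc m) p ++ ν) + X * Φ (replicate (suc m) p ++ ν)
          ≡⟨ cong₂ (λ l t → P * a * X ^ℚ l + X * t) (length-block (suc m) p ν) (Φ-block p (suc m) ν) ⟩
        P * a * (X * T) + X * (M * a * T + U * F)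
          ≡⟨ solve 7 (λ P a X T M U F → P :* a :* (X :* T) :+ X :* (M :* a :* T :+ U :* F)
                                      := (P :+ M) :* a :* (X :* T) :+ (X :* U) :* F) refl P a X T M U F ⟩
        (P + M) * a * (X * T) + (X * U) * F
          ≡⟨ cong (λ t → t * a * (X * T) + (X * U) * F) (ℕ→ℚ-+ p (suc m ℕ.* p)) ⟨
        Φ-blockHead p (suc (suc m)) ν + X ^ℚ suc (suc m) * Φ ν ∎
        where
        P = ℕ→ℚ p
        a = A p
        T = X ^ℚ (m ℕ.+ length ν)
        M = ℕ→ℚ (suc m ℕ.* p)
        U = X ^ℚ suc m
        F = Φ ν

      ΦSum≤ : ℕ → ℕ → ℚ
      ΦSum≤ b n = sumℚ (map (λ μ → ω μ * Φ μ) (partitions≤ b n))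

      headSum : ℕ → ℕ → ℕ → ℚ
      headSum b n m = blockWeight (suc b) m * sumℚ (map (λ ν → ω ν * Φ-blockHead (suc b) m ν) (partitions≤ b (n ∸ m ℕ.* suc b)))

      ∑-Φ-block : ∀ b n m → let p = suc b; N = n ∸ m ℕ.* p in
        sumℚ (map (λ ν → ω (replicate m p ++ ν) * Φ (replicate m p ++ ν)) (partitions≤ b N))
          ≡ headSum b n m + blockWeight p m * (X ^ℚ m * ΦSum≤ b N)
      ∑-Φ-block b n m = begin
        sumℚ (map (λ ν → ω (replicate m p ++ ν) * Φ (replicate m p ++ ν)) νs)
          ≡⟨ sumℚ-cong νs (λ {ν} ν∈ → trans (cong₂ _*_ (ω-block m (proj₁ (partitions≤-sound b _ ν∈))) (Φ-block p m ν))
               (solve 5 (λ w o h x f → (w :* o) :* (h :+ x :* f) := w :* (o :* h) :+ w :* (x :* (o :* f))) refl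
                        w (ω ν) (Φ-blockHead p m ν) x (Φ ν))) ⟩
        sumℚ (map (λ ν → w * (ω ν * Φ-blockHead p m ν) + w * (x * (ω ν * Φ ν))) νs)
          ≡⟨ sumℚ-+ (λ ν → w * (ω ν * Φ-blockHead p m ν)) (λ ν → w * (x * (ω ν * Φ ν))) νs ⟩
        sumℚ (map (λ ν → w * (ω ν * Φ-blockHead p m ν)) νs) + sumℚ (map (λ ν → w * (x * (ω ν * Φ ν))) νs)
          ≡⟨ cong₂ _+_ (sumℚ-*ˡ w (λ ν → ω ν * Φ-blockHead p m ν) νs)
                       (trans (sumℚ-*ˡ w (λ ν → x * (ω ν * Φ ν)) νs) (cong (w *_) (sumℚ-*ˡ x (λ ν → ω ν * Φ ν) νs))) ⟩
        headSum b n m + w * (x * ΦSum≤ b (n ∸ m ℕ.* p)) ∎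
        where
        p = suc b
        νs = partitions≤ b (n ∸ m ℕ.* p)
        w = blockWeight p m
        x = X ^ℚ m

      headSum-suc : ∀ b n m → headSum b n (suc m) ≡ A (suc b) * (blockWeight (suc b) m * (X ^ℚ m * cycleIndex≤ b (n ∸ suc m ℕ.* suc b)))
      headSum-suc b n m = begin
        w′ * sumℚ (map (λ ν → ω ν * (M * A p * X ^ℚ (m ℕ.+ length ν))) νs)
          ≡⟨ cong (w′ *_) (sumℚ-cong νs (λ {ν} _ → trans (cong (λ t → ω ν * (M * A p * t)) (^ℚ-+ X m (length ν)))
               (solve 5 (λ o M a x y → o :* (M :* a :* (x :* y)) := (M :* a :* x) :* (o :* y)) refl
                        (ω ν) M (A p) (X ^ℚ m) (X ^ℚ length ν)))) ⟩
        w′ * sumℚ (map (λ ν → (M * A p * X ^ℚ m) * (ω ν * X ^ℚ length ν)) νs)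
          ≡⟨ cong (w′ *_) (sumℚ-*ˡ (M * A p * X ^ℚ m) (λ ν → ω ν * X ^ℚ length ν) νs) ⟩
        w′ * ((M * A p * X ^ℚ m) * C)
          ≡⟨ solve 5 (λ w M a x s → w :* ((M :* a :* x) :* s) := a :* ((w :* M) :* (x :* s))) refl w′ M (A p) (X ^ℚ m) C ⟩
        A p * ((w′ * M) * (X ^ℚ m * C))
          ≡⟨ cong (λ t → A p * (t * (X ^ℚ m * C))) (blockWeight-suc p m) ⟩
        A p * (blockWeight p m * (X ^ℚ m * C)) ∎
        where
        p = suc b
        νs = partitions≤ b (n ∸ suc m ℕ.* p)
        w′ = blockWeight p (suc m)
        M = ℕ→ℚ (suc m ℕ.* p)
        C = cycleIndex≤ b (n ∸ suc m ℕ.* p)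

      guard-headSum-suc : ∀ b n m → let p = suc b in
        guard (suc m ℕ.* p) n (headSum b n (suc m)) ≡ A p * guard p n (blockTerm p (cycleIndex≤ b) (n ∸ p) m)
      guard-headSum-suc b n m = begin
        guard (p ℕ.+ m ℕ.* p) n (headSum b n (suc m))
          ≡⟨ cong (guard (p ℕ.+ m ℕ.* p) n) (headSum-suc b n m) ⟩
        guard (p ℕ.+ m ℕ.* p) n (A p * Y (n ∸ (p ℕ.+ m ℕ.* p)))
          ≡⟨ guard-*ˡ (A p) (p ℕ.+ m ℕ.* p) n _ ⟨
        A p * guard (p ℕ.+ m ℕ.* p) n (Y (n ∸ (p ℕ.+ m ℕ.* p)))
          ≡⟨ cong (A p *_) (guard-shift p (m ℕ.* p) n _) ⟩
        A p * guard p n (guard (m ℕ.* p) (n ∸ p) (Y (n ∸ (p ℕ.+ m ℕ.* p))))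
          ≡⟨ cong (λ N → A p * guard p n (guard (m ℕ.* p) (n ∸ p) (Y N))) (ℕ.∸-+-assoc n p (m ℕ.* p)) ⟨
        A p * guard p n (blockTerm p (cycleIndex≤ b) (n ∸ p) m) ∎
        where
        p = suc b
        Y : ℕ → ℚ
        Y N = blockWeight p m * (X ^ℚ m * cycleIndex≤ b N)

      -- The blocks of m ≥ 1 parts p, with one part p removed, are the blocks of m - 1 parts p.
      ∑-headSum : ∀ b n → let p = suc b in
        ∑[ m < suc n ] guard (m ℕ.* p) n (headSum b n m) ≡ A p * guard p n (cycleIndex≤ p (n ∸ p))
      ∑-headSum b n = begin
        ∑[ m < suc n ] guard (m ℕ.* p) n (headSum b n m)
          ≡⟨ ∑<-suc-head n (λ m → guard (m ℕ.* p) n (headSum b n m)) ⟩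
        guard 0 n (headSum b n 0) + ∑[ m < n ] guard (suc m ℕ.* p) n (headSum b n (suc m))
          ≡⟨ cong₂ _+_ (trans (cong (blockWeight p 0 *_) (sumℚ-zero (partitions≤ b n) (λ {ν} _ → *-zeroʳ (ω ν))))
                              (*-zeroʳ (blockWeight p 0)))
                       (∑<-cong n (λ {m} _ → guard-headSum-suc b n m)) ⟩
        0ℚ + ∑[ m < n ] (A p * guard p n (blockTerm p (cycleIndex≤ b) (n ∸ p) m))
          ≡⟨ +-identityˡ _ ⟩
        ∑[ m < n ] (A p * guard p n (blockTerm p (cycleIndex≤ b) (n ∸ p) m))
          ≡⟨ ∑<-*ˡ n (A p) (λ m → guard p n (blockTerm p (cycleIndex≤ b) (n ∸ p) m)) ⟩
        A p * ∑[ m < n ] guard p n (blockTerm p (cycleIndex≤ b) (n ∸ p) m)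
          ≡⟨ cong (A p *_) (guard-∑ p n n (blockTerm p (cycleIndex≤ b) (n ∸ p))) ⟩
        A p * guard p n (∑< n (blockTerm p (cycleIndex≤ b) (n ∸ p)))
          ≡⟨ cong (A p *_) (guard-cong (λ p≤n → trans (blockSum-range p (cycleIndex≤ b) (n ∸ p) n (ℕ.∸-monoʳ-< (s≤s z≤n) p≤n))
                                                        (sym (cycleIndex≤-suc b (n ∸ p))))) ⟩
        A p * guard p n (cycleIndex≤ p (n ∸ p)) ∎
        where p = suc b

      ΦSum≤-suc : ∀ b n → let p = suc b in
        ΦSum≤ p n ≡ A p * guard p n (cycleIndex≤ p (n ∸ p)) + blockSum p (ΦSum≤ b) n
      ΦSum≤-suc b n = begin
        ΦSum≤ p n
          ≡⟨ ∑-partitions≤-suc b n (λ μ → ω μ * Φ μ) ⟩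
        ∑[ m < suc n ] guard (m ℕ.* p) n (sumℚ (map (λ ν → ω (replicate m p ++ ν) * Φ (replicate m p ++ ν))
                                                   (partitions≤ b (n ∸ m ℕ.* p))))
          ≡⟨ ∑<-cong (suc n) (λ {m} _ →
               trans (cong (guard (m ℕ.* p) n) (∑-Φ-block b n m)) (guard-+ (m ℕ.* p) n (headSum b n m) _)) ⟩
        ∑[ m < suc n ] (guard (m ℕ.* p) n (headSum b n m) + blockTerm p (ΦSum≤ b) n m)
          ≡⟨ ∑<-+ (suc n) (λ m → guard (m ℕ.* p) n (headSum b n m)) (blockTerm p (ΦSum≤ b) n) ⟩
        ∑[ m < suc n ] guard (m ℕ.* p) n (headSum b n m) + blockSum p (ΦSum≤ b) n
          ≡⟨ cong (_+ blockSum p (ΦSum≤ b) n) (∑-headSum b n) ⟩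
        A p * guard p n (cycleIndex≤ p (n ∸ p)) + blockSum p (ΦSum≤ b) n ∎
        where p = suc b

      ΦSum≤-closed : ∀ b n → ΦSum≤ b n ≡ ∑[ j < b ] (A (suc j) * guard (suc j) n (cycleIndex≤ b (n ∸ suc j)))
      ΦSum≤-closed zero    zero    = refl
      ΦSum≤-closed zero    (suc n) = refl
      ΦSum≤-closed (suc b) n = begin
        ΦSum≤ p n
          ≡⟨ ΦSum≤-suc b n ⟩
        A p * guard p n (cycleIndex≤ p (n ∸ p)) + blockSum p (ΦSum≤ b) n
          ≡⟨ cong (A p * guard p n (cycleIndex≤ p (n ∸ p)) +_) (begin
               blockSum p (ΦSum≤ b) n
                 ≡⟨ blockSum-cong p n (ΦSum≤-closed b) ⟩
               blockSum p (λ N → ∑[ j < b ] (A (suc j) * H j N)) n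
                 ≡⟨ blockSum-∑ p b (λ j → A (suc j)) H n ⟩
               ∑[ j < b ] (A (suc j) * blockSum p (H j) n)
                 ≡⟨ ∑<-cong b (λ {j} _ → cong (A (suc j) *_) (trans (blockSum-delay p (suc j) (cycleIndex≤ b) n)
                                                                   (cong (guard (suc j) n) (sym (cycleIndex≤-suc b (n ∸ suc j)))))) ⟩
               ∑[ j < b ] (A (suc j) * guard (suc j) n (cycleIndex≤ p (n ∸ suc j))) ∎) ⟩
        A p * guard p n (cycleIndex≤ p (n ∸ p)) + ∑[ j < b ] (A (suc j) * guard (suc j) n (cycleIndex≤ p (n ∸ suc j)))
          ≡⟨ +-comm (A p * guard p n (cycleIndex≤ p (n ∸ p))) _ ⟩
        ∑[ j < b ] (A (suc j) * guard (suc j) n (cycleIndex≤ p (n ∸ suc j))) + A p * guard p n (cycleIndex≤ p (n ∸ p))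
          ≡⟨ ∑<-suc b (λ j → A (suc j) * guard (suc j) n (cycleIndex≤ p (n ∸ suc j))) ⟨
        ∑[ j < p ] (A (suc j) * guard (suc j) n (cycleIndex≤ p (n ∸ suc j))) ∎
        where
        p = suc b
        H : ℕ → ℕ → ℚ
        H j N = guard (suc j) N (cycleIndex≤ b (N ∸ suc j))

      -- Removing one part j from a partition of n leaves a partition of n - j, weighted by j · mⱼ / z.
      removePart : ∀ n → sumℚ (map (λ μ → ω μ * Φ μ) (partitions n)) ≡ ∑[ j < n ] (A (suc j) * cycleIndex (n ∸ suc j))
      removePart n = begin
        sumℚ (map (λ μ → ω μ * Φ μ) (partitions n))
          ≡⟨ sumℚ-↭ (λ μ → ω μ * Φ μ) (partitions↭partitions≤ n n ℕ.≤-refl) ⟩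
        ΦSum≤ n n
          ≡⟨ ΦSum≤-closed n n ⟩
        ∑[ j < n ] (A (suc j) * guard (suc j) n (cycleIndex≤ n (n ∸ suc j)))
          ≡⟨ ∑<-cong n (λ {j} j<n → cong (A (suc j) *_) (trans (guard-yes _ j<n)
               (sym (sumℚ-↭ (λ ν → ω ν * X ^ℚ length ν) (partitions↭partitions≤ (n ∸ suc j) n (ℕ.m∸n≤m n (suc j))))))) ⟩
        ∑[ j < n ] (A (suc j) * cycleIndex (n ∸ suc j)) ∎

    Φ-const : ∀ μ → Φ (λ _ → X) μ ≡ ℕ→ℚ (sumℕ μ) * X ^ℚ length μ
    Φ-const []      = *-zeroˡ 1ℚ
    Φ-const (c ∷ ν) = begin
      ℕ→ℚ c * X * X ^ℚ length ν + X * Φ (λ _ → X) ν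
        ≡⟨ cong (λ t → ℕ→ℚ c * X * X ^ℚ length ν + X * t) (Φ-const ν) ⟩
      ℕ→ℚ c * X * X ^ℚ length ν + X * (ℕ→ℚ (sumℕ ν) * X ^ℚ length ν)
        ≡⟨ solve 4 (λ C X P S → C :* X :* P :+ X :* (S :* P) := (C :+ S) :* (X :* P)) refl
                   (ℕ→ℚ c) X (X ^ℚ length ν) (ℕ→ℚ (sumℕ ν)) ⟩
      (ℕ→ℚ c + ℕ→ℚ (sumℕ ν)) * (X * X ^ℚ length ν)
        ≡⟨ cong (_* (X * X ^ℚ length ν)) (ℕ→ℚ-+ c (sumℕ ν)) ⟨
      ℕ→ℚ (sumℕ (c ∷ ν)) * X ^ℚ length (c ∷ ν) ∎

    -- Φ with A(j) = X turns removePart into the recursion N · S(N) = X Σ_{j<N} S(j).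
    cycleIndex≡multichoose : ∀ N → cycleIndex N ≡ multichoose X N
    cycleIndex≡multichoose = <-rec (λ N → cycleIndex N ≡ multichoose X N) step
      where
      step : ∀ N → (∀ {M} → M < N → cycleIndex M ≡ multichoose X M) → cycleIndex N ≡ multichoose X N
      step zero    _   = refl
      step (suc k) rec = *-cancelˡ-invertible (inv (suc k)) (ℕ→ℚ (suc k)) (inv*ℕ→ℚ (suc k)) (begin
        ℕ→ℚ (suc k) * cycleIndex (suc k)
          ≡⟨ sumℚ-*ˡ (ℕ→ℚ (suc k)) (λ ν → ω ν * X ^ℚ length ν) (partitions (suc k)) ⟨
        sumℚ (map (λ μ → ℕ→ℚ (suc k) * (ω μ * X ^ℚ length μ)) (partitions (suc k)))
          ≡⟨ sumℚ-cong (partitions (suc k)) (λ {μ} μ∈ → trans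
               (solve 3 (λ c o x → c :* (o :* x) := o :* (c :* x)) refl (ℕ→ℚ (suc k)) (ω μ) (X ^ℚ length μ))
               (cong (ω μ *_) (trans (cong (λ t → ℕ→ℚ t * X ^ℚ length μ) (sym (proj₂ (partitions-sound (suc k) μ∈))))
                                     (sym (Φ-const μ))))) ⟩
        sumℚ (map (λ μ → ω μ * Φ (λ _ → X) μ) (partitions (suc k)))
          ≡⟨ removePart (λ _ → X) (suc k) ⟩
        ∑[ j < suc k ] (X * cycleIndex (k ∸ j))
          ≡⟨ ∑<-cong (suc k) (λ {j} _ → cong (X *_) (rec (s≤s (ℕ.m∸n≤m k j)))) ⟩
        ∑[ j < suc k ] (X * multichoose X (k ∸ j))
          ≡⟨ ∑<-*ˡ (suc k) X (λ j → multichoose X (k ∸ j)) ⟩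
        X * ∑[ j < suc k ] multichoose X (k ∸ j)
          ≡⟨ cong (X *_) (multichoose-hockey k X) ⟩
        X * multichoose (X + 1ℚ) k
          ≡⟨ multichoose-absorb k X ⟨
        ℕ→ℚ (suc k) * multichoose X (suc k) ∎)

    Φ-parts : ∀ (F : ℕ → ℚ) {μ} → All (1 ≤_) μ → Φ (λ j → F j * inv j) μ ≡ X ^ℚ (length μ ∸ 1) * sumℚ (map F μ)
    Φ-parts F []                             = sym (*-zeroʳ 1ℚ)
    Φ-parts F {suc c ∷ ν} (_ ∷ ν-positive) = begin
      ℕ→ℚ (suc c) * (F (suc c) * inv (suc c)) * X ^ℚ length ν + X * Φ (λ j → F j * inv j) ν
        ≡⟨ cong₂ (λ s t → s * X ^ℚ length ν + X * t) cancel (Φ-parts F ν-positive) ⟩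
      F (suc c) * X ^ℚ length ν + X * (X ^ℚ (length ν ∸ 1) * sumℚ (map F ν))
        ≡⟨ cong (F (suc c) * X ^ℚ length ν +_) (raise ν) ⟩
      F (suc c) * X ^ℚ length ν + X ^ℚ length ν * sumℚ (map F ν)
        ≡⟨ solve 3 (λ f p s → f :* p :+ p :* s := p :* (f :+ s)) refl (F (suc c)) (X ^ℚ length ν) (sumℚ (map F ν)) ⟩
      X ^ℚ length ν * (F (suc c) + sumℚ (map F ν)) ∎
      where
      cancel : ℕ→ℚ (suc c) * (F (suc c) * inv (suc c)) ≡ F (suc c)
      cancel = trans (solve 3 (λ n f i → n :* (f :* i) := f :* (n :* i)) refl (ℕ→ℚ (suc c)) (F (suc c)) (inv (suc c)))
                     (trans (cong (F (suc c) *_) (ℕ→ℚ*inv (suc c))) (*-identityʳ (F (suc c))))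
      -- For ν = [] both sides vanish, despite the truncated exponent.
      raise : ∀ ν → X * (X ^ℚ (length ν ∸ 1) * sumℚ (map F ν)) ≡ X ^ℚ length ν * sumℚ (map F ν)
      raise []      = trans (cong (X *_) (*-zeroʳ 1ℚ)) (trans (*-zeroʳ X) (sym (*-zeroʳ 1ℚ)))
      raise (d ∷ ν) = sym (*-assoc X _ _)

    ∑-partitions-closed : ∀ (F : ℕ → ℚ) n →
      sumℚ (map (λ μ → (X ^ℚ (length μ ∸ 1)) * inv (z μ) * sumℚ (map F μ)) (partitions n))
        ≡ ∑[ j < n ] (F (suc j) * inv (suc j) * multichoose X (n ∸ suc j))
    ∑-partitions-closed F n = begin
      sumℚ (map (λ μ → (X ^ℚ (length μ ∸ 1)) * inv (z μ) * sumℚ (map F μ)) (partitions n))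
        ≡⟨ sumℚ-cong (partitions n) (λ {μ} μ∈ → trans
             (solve 3 (λ x o s → x :* o :* s := o :* (x :* s)) refl (X ^ℚ (length μ ∸ 1)) (inv (z μ)) (sumℚ (map F μ)))
             (cong (ω μ *_) (sym (Φ-parts F (All-positive (proj₁ (partitions-sound n μ∈))))))) ⟩
      sumℚ (map (λ μ → ω μ * Φ (λ j → F j * inv j) μ) (partitions n))
        ≡⟨ removePart (λ j → F j * inv j) n ⟩
      ∑[ j < n ] (F (suc j) * inv (suc j) * cycleIndex (n ∸ suc j))
        ≡⟨ ∑<-cong n (λ {j} _ → cong (F (suc j) * inv (suc j) *_) (cycleIndex≡multichoose (n ∸ suc j))) ⟩
      ∑[ j < n ] (F (suc j) * inv (suc j) * multichoose X (n ∸ suc j)) ∎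

module Coefficients where

  open import Data.Nat as ℕ using (ℕ; zero; suc; _<_; _∸_; _!; s≤s; NonZero)
  import Data.Nat.Properties as ℕ
  open import Data.Nat.Combinatorics using (_C_; nCk+nC[k+1]≡[n+1]C[k+1])
  open import Data.Fin using (Fin; toℕ; fromℕ<)
  import Data.Fin.Properties as Fin
  open import Data.Rational using (ℚ; 0ℚ; 1ℚ; _+_; _*_; _-_)
  open import Data.Rational.Properties using (*-zeroˡ; *-zeroʳ; *-identityʳ; *-assoc; *-distribˡ-+)
  open import Data.Rational.Solver using (module +-*-Solver)
  open import Data.List using (List; []; _∷_; map; allFin)
  import Data.List.Properties as List
  open import Data.Product using (proj₁; proj₂)
  open import Relation.Nullary using (yes; no; contradiction)
  open import Relation.Binary.PropositionalEquality
  open ≡-Reasoning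
  open +-*-Solver
  open Cast
  open Sums
  open Binomial using (∑-binomial*multichoose; binomℚ-basis-unique)
  open BinomialIdentities using (rising≡!*C)
  open Newton using (newton)
  open BinomialProducts
  open PartitionSums using (∑-partitions-closed)

  coefficient : List ℕ → ℕ → ℕ
  coefficient []       k       = 0
  coefficient (c ∷ cs) zero    = c
  coefficient (c ∷ cs) (suc k) = coefficient cs k

  newton≡∑binomial : ∀ cs {N y} → y < N → ℕ→ℚ (newton cs y) ≡ ∑[ k < N ] (ℕ→ℚ (coefficient cs k) * ℕ→ℚ (y C k))
  newton≡∑binomial []       {N}     {y}     _ = sym (∑<-zero N (λ {k} _ → *-zeroˡ (ℕ→ℚ (y C k))))
  newton≡∑binomial (c ∷ cs) {suc N} {zero}  _ = begin
    ℕ→ℚ c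
      ≡⟨ solve 1 (λ c → c := c :* con 1ℚ :+ con 0ℚ) refl (ℕ→ℚ c) ⟩
    ℕ→ℚ c * 1ℚ + 0ℚ
      ≡⟨ cong (ℕ→ℚ c * 1ℚ +_) (∑<-zero N (λ {k} _ → *-zeroʳ (ℕ→ℚ (coefficient cs k)))) ⟨
    ℕ→ℚ c * 1ℚ + ∑[ k < N ] (ℕ→ℚ (coefficient cs k) * ℕ→ℚ (0 C suc k))
      ≡⟨ ∑<-suc-head N (λ k → ℕ→ℚ (coefficient (c ∷ cs) k) * ℕ→ℚ (0 C k)) ⟨
    ∑[ k < suc N ] (ℕ→ℚ (coefficient (c ∷ cs) k) * ℕ→ℚ (0 C k)) ∎
  newton≡∑binomial (c ∷ cs) {suc N} {suc y} (s≤s y<N) = begin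
    ℕ→ℚ (newton (c ∷ cs) y ℕ.+ newton cs y)
      ≡⟨ ℕ→ℚ-+ (newton (c ∷ cs) y) (newton cs y) ⟩
    ℕ→ℚ (newton (c ∷ cs) y) + ℕ→ℚ (newton cs y)
      ≡⟨ cong₂ _+_ (trans (newton≡∑binomial (c ∷ cs) (ℕ.m<n⇒m<1+n y<N)) (∑<-suc-head N (λ k → a k * ℕ→ℚ (y C k))))
                   (newton≡∑binomial cs y<N) ⟩
    (ℕ→ℚ c * 1ℚ + ∑[ k < N ] (b k * ℕ→ℚ (y C suc k))) + ∑[ k < N ] (b k * ℕ→ℚ (y C k))
      ≡⟨ solve 3 (λ x u v → (x :+ u) :+ v := x :+ (v :+ u)) refl
                 (ℕ→ℚ c * 1ℚ) (∑[ k < N ] (b k * ℕ→ℚ (y C suc k))) (∑[ k < N ] (b k * ℕ→ℚ (y C k))) ⟩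
    ℕ→ℚ c * 1ℚ + (∑[ k < N ] (b k * ℕ→ℚ (y C k)) + ∑[ k < N ] (b k * ℕ→ℚ (y C suc k)))
      ≡⟨ cong (ℕ→ℚ c * 1ℚ +_) (trans (∑<-cong N (λ {k} _ → pascal k))
                                     (∑<-+ N (λ k → b k * ℕ→ℚ (y C k)) (λ k → b k * ℕ→ℚ (y C suc k)))) ⟨
    ℕ→ℚ c * 1ℚ + ∑[ k < N ] (b k * ℕ→ℚ (suc y C suc k))
      ≡⟨ ∑<-suc-head N (λ k → a k * ℕ→ℚ (suc y C k)) ⟨
    ∑[ k < suc N ] (a k * ℕ→ℚ (suc y C k)) ∎
    where
    a = λ k → ℕ→ℚ (coefficient (c ∷ cs) k)
    b = λ k → ℕ→ℚ (coefficient cs k)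
    pascal : ∀ k → b k * ℕ→ℚ (suc y C suc k) ≡ b k * ℕ→ℚ (y C k) + b k * ℕ→ℚ (y C suc k)
    pascal k = trans (cong (λ t → b k * ℕ→ℚ t) (sym (nCk+nC[k+1]≡[n+1]C[k+1] y k)))
                     (trans (cong (b k *_) (ℕ→ℚ-+ (y C k) (y C suc k))) (*-distribˡ-+ (b k) _ _))

  module _ {m : ℕ} (r : Fin m → ℕ) where

    private
      rs : List ℕ
      rs = map r (allFin m)

      F : ℕ → ℚ
      F j = prodℚ (map (λ k → ℕ→ℚ (rising j (r k)) * inv (r k !)) (allFin m))

      F-suc : ∀ y → F (suc y) ≡ ℕ→ℚ (binomialProduct rs y)
      F-suc y = begin
        F (suc y)                                       ≡⟨ cong prodℚ (List.map-∘ (allFin m)) ⟩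
        prodℚ (map G rs)                                ≡⟨ cong prodℚ (List.map-cong rising/! rs) ⟩
        prodℚ (map (λ s → ℕ→ℚ ((y ℕ.+ s) C s)) rs)      ≡⟨ ℕ→ℚ-prodℕ (λ s → (y ℕ.+ s) C s) rs ⟩
        ℕ→ℚ (binomialProduct rs y)                      ∎
        where
        G : ℕ → ℚ
        G s = ℕ→ℚ (rising (suc y) s) * inv (s !)
        rising/! : ∀ s → G s ≡ ℕ→ℚ ((y ℕ.+ s) C s)
        rising/! s = begin
          ℕ→ℚ (rising (suc y) s) * inv (s !)
            ≡⟨ cong (λ t → ℕ→ℚ t * inv (s !)) (rising≡!*C y s) ⟩
          ℕ→ℚ (s ! ℕ.* c) * inv (s !)
            ≡⟨ cong (_* inv (s !)) (ℕ→ℚ-* (s !) c) ⟩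
          (ℕ→ℚ (s !) * ℕ→ℚ c) * inv (s !)
            ≡⟨ solve 3 (λ a c i → (a :* c) :* i := c :* (a :* i)) refl (ℕ→ℚ (s !)) (ℕ→ℚ c) (inv (s !)) ⟩
          ℕ→ℚ c * (ℕ→ℚ (s !) * inv (s !))
            ≡⟨ cong (ℕ→ℚ c *_) (ℕ→ℚ*inv (s !) {{s ℕ.!≢0}}) ⟩
          ℕ→ℚ c * 1ℚ
            ≡⟨ *-identityʳ (ℕ→ℚ c) ⟩
          ℕ→ℚ c ∎
          where c = (y ℕ.+ s) C s

      size*F/suc : ∀ y → ℕ→ℚ (size r) * (F (suc y) * inv (suc y)) ≡ ℕ→ℚ (binomialQuotient rs y)
      size*F/suc y = begin
        ℕ→ℚ (size r) * (F (suc y) * inv (suc y))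
          ≡⟨ cong (λ t → ℕ→ℚ (size r) * (t * inv (suc y))) (F-suc y) ⟩
        ℕ→ℚ (size r) * (ℕ→ℚ P * inv (suc y))
          ≡⟨ *-assoc (ℕ→ℚ (size r)) (ℕ→ℚ P) (inv (suc y)) ⟨
        (ℕ→ℚ (size r) * ℕ→ℚ P) * inv (suc y)
          ≡⟨ cong (_* inv (suc y)) (ℕ→ℚ-* (size r) P) ⟨
        ℕ→ℚ (size r ℕ.* P) * inv (suc y)
          ≡⟨ cong (λ t → ℕ→ℚ t * inv (suc y)) (suc*binomialQuotient rs y) ⟨
        ℕ→ℚ (suc y ℕ.* Q) * inv (suc y)
          ≡⟨ cong (_* inv (suc y)) (ℕ→ℚ-* (suc y) Q) ⟩
        (ℕ→ℚ (suc y) * ℕ→ℚ Q) * inv (suc y)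
          ≡⟨ solve 3 (λ a q i → (a :* q) :* i := q :* (a :* i)) refl (ℕ→ℚ (suc y)) (ℕ→ℚ Q) (inv (suc y)) ⟩
        ℕ→ℚ Q * (ℕ→ℚ (suc y) * inv (suc y))
          ≡⟨ cong (ℕ→ℚ Q *_) (ℕ→ℚ*inv (suc y)) ⟩
        ℕ→ℚ Q * 1ℚ
          ≡⟨ *-identityʳ (ℕ→ℚ Q) ⟩
        ℕ→ℚ Q ∎
        where
        P = binomialProduct rs y
        Q = binomialQuotient rs y

    coefficients : List ℕ
    coefficients = proj₁ (NewtonExpansion-binomialQuotient rs)

    size*lhs : ∀ n X → ℕ→ℚ (size r) * lhs n r X ≡
               ∑[ k < n ] (ℕ→ℚ (coefficient coefficients k) * binomℚ (X + ℕ→ℚ n - 1ℚ) (n ∸ suc k))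
    size*lhs n X = begin
      ℕ→ℚ (size r) * lhs n r X
        ≡⟨ cong (ℕ→ℚ (size r) *_) (∑-partitions-closed X F n) ⟩
      ℕ→ℚ (size r) * ∑[ y < n ] (F (suc y) * inv (suc y) * M y)
        ≡⟨ ∑<-*ˡ n (ℕ→ℚ (size r)) (λ y → F (suc y) * inv (suc y) * M y) ⟨
      ∑[ y < n ] (ℕ→ℚ (size r) * (F (suc y) * inv (suc y) * M y))
        ≡⟨ ∑<-cong n (λ {y} y<n → trans (sym (*-assoc (ℕ→ℚ (size r)) _ (M y))) (cong (_* M y) (trans (size*F/suc y) (expand y<n)))) ⟩
      ∑[ y < n ] (∑[ k < n ] (c k * ℕ→ℚ (y C k)) * M y)
        ≡⟨ ∑<-cong n (λ {y} _ → trans (sym (∑<-*ʳ n (M y) (λ k → c k * ℕ→ℚ (y C k))))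
                                      (∑<-cong n (λ {k} _ → *-assoc (c k) (ℕ→ℚ (y C k)) (M y)))) ⟩
      ∑[ y < n ] ∑[ k < n ] (c k * (ℕ→ℚ (y C k) * M y))
        ≡⟨ ∑<-swap n n (λ y k → c k * (ℕ→ℚ (y C k) * M y)) ⟩
      ∑[ k < n ] ∑[ y < n ] (c k * (ℕ→ℚ (y C k) * M y))
        ≡⟨ ∑<-cong n (λ {k} k<n → trans (∑<-*ˡ n (c k) (λ y → ℕ→ℚ (y C k) * M y))
                                        (cong (c k *_) (∑-binomial*multichoose X n k k<n))) ⟩
      ∑[ k < n ] (c k * binomℚ (X + ℕ→ℚ n - 1ℚ) (n ∸ suc k)) ∎
      where
      M = λ y → Binomial.multichoose X (n ∸ suc y)
      c = λ k → ℕ→ℚ (coefficient coefficients k)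
      expand : ∀ {y} → y < n → ℕ→ℚ (binomialQuotient rs y) ≡ ∑[ k < n ] (c k * ℕ→ℚ (y C k))
      expand {y} y<n = trans (cong ℕ→ℚ (proj₂ (NewtonExpansion-binomialQuotient rs) y)) (newton≡∑binomial coefficients y<n)

    coefficients-Defining : ∀ n .{{_ : NonZero (size r)}} → Defining n r (λ k → ℕ→ℚ (coefficient coefficients (toℕ k)))
    coefficients-Defining n X = begin
      lhs n r X
        ≡⟨ solve 1 (λ x → x := con 1ℚ :* x) refl (lhs n r X) ⟩
      1ℚ * lhs n r X
        ≡⟨ cong (_* lhs n r X) (inv*ℕ→ℚ (size r)) ⟨
      (inv (size r) * ℕ→ℚ (size r)) * lhs n r X
        ≡⟨ *-assoc (inv (size r)) (ℕ→ℚ (size r)) (lhs n r X) ⟩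
      inv (size r) * (ℕ→ℚ (size r) * lhs n r X)
        ≡⟨ cong (inv (size r) *_) (size*lhs n X) ⟩
      inv (size r) * ∑[ k < n ] (ℕ→ℚ (coefficient coefficients k) * binomℚ (X + ℕ→ℚ n - 1ℚ) (n ∸ suc k))
        ≡⟨ cong (inv (size r) *_)
                (∑<-allFin n (λ k → ℕ→ℚ (coefficient coefficients k) * binomℚ (X + ℕ→ℚ n - 1ℚ) (n ∸ suc k))) ⟨
      rhs n r (λ k → ℕ→ℚ (coefficient coefficients (toℕ k))) X ∎

  private
    extend : ∀ {n} → (Fin n → ℚ) → ℕ → ℚ
    extend {n} c j with j ℕ.<? n
    ... | yes j<n = c (fromℕ< j<n)
    ... | no  _   = 0ℚ

    extend-toℕ : ∀ {n} (c : Fin n → ℚ) k → extend c (toℕ k) ≡ c k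
    extend-toℕ {n} c k with toℕ k ℕ.<? n
    ... | yes k<n = cong c (Fin.fromℕ<-toℕ k k<n)
    ... | no  k≮n = contradiction (Fin.toℕ<n k) k≮n

    reflect : ∀ {n e} → e < n → n ∸ suc (n ∸ suc e) ≡ e
    reflect (s≤s e≤n) = ℕ.m∸[m∸n]≡n e≤n

    combination : ∀ n (c : Fin n → ℚ) Y →
      sumℚ (map (λ k → c k * binomℚ Y (n ∸ suc (toℕ k))) (allFin n)) ≡ ∑[ e < n ] (extend c (n ∸ suc e) * binomℚ Y e)
    combination n c Y = begin
      sumℚ (map (λ k → c k * binomℚ Y (n ∸ suc (toℕ k))) (allFin n))
        ≡⟨ sumℚ-cong (allFin n) (λ {k} _ → cong (_* binomℚ Y (n ∸ suc (toℕ k))) (sym (extend-toℕ c k))) ⟩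
      sumℚ (map (λ k → extend c (toℕ k) * binomℚ Y (n ∸ suc (toℕ k))) (allFin n))
        ≡⟨ ∑<-allFin n (λ j → extend c j * binomℚ Y (n ∸ suc j)) ⟩
      ∑[ j < n ] (extend c j * binomℚ Y (n ∸ suc j))
        ≡⟨ ∑<-reverse n (λ j → extend c j * binomℚ Y (n ∸ suc j)) ⟨
      ∑[ e < n ] (extend c (n ∸ suc e) * binomℚ Y (n ∸ suc (n ∸ suc e)))
        ≡⟨ ∑<-cong n (λ {e} e<n → cong (λ i → extend c (n ∸ suc e) * binomℚ Y i) (reflect e<n)) ⟩
      ∑[ e < n ] (extend c (n ∸ suc e) * binomℚ Y e) ∎

  Defining-unique : ∀ {m} n (r : Fin m → ℕ) .{{_ : NonZero (size r)}} {c c′ : Fin n → ℚ} →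
                    Defining n r c → Defining n r c′ → ∀ k → c′ k ≡ c k
  Defining-unique n r {c} {c′} c-defining c′-defining k = begin
    c′ k
      ≡⟨ extend-toℕ c′ k ⟨
    extend c′ (toℕ k)
      ≡⟨ cong (extend c′) (reflect (Fin.toℕ<n k)) ⟨
    extend c′ (n ∸ suc e)
      ≡⟨ binomℚ-basis-unique n (λ e → extend c′ (n ∸ suc e)) (λ e → extend c (n ∸ suc e)) same
                             (ℕ.∸-monoʳ-< (s≤s ℕ.z≤n) (Fin.toℕ<n k)) ⟩
    extend c (n ∸ suc e)
      ≡⟨ cong (extend c) (reflect (Fin.toℕ<n k)) ⟩
    extend c (toℕ k)
      ≡⟨ extend-toℕ c k ⟩
    c k ∎
    where
    e = n ∸ suc (toℕ k)
    same : ∀ Y → ∑[ e < n ] (extend c′ (n ∸ suc e) * binomℚ Y e) ≡ ∑[ e < n ] (extend c (n ∸ suc e) * binomℚ Y e)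
    same Y = begin
      ∑[ e < n ] (extend c′ (n ∸ suc e) * binomℚ Y e)
        ≡⟨ combination n c′ Y ⟨
      sumℚ (map (λ k → c′ k * binomℚ Y (n ∸ suc (toℕ k))) (allFin n))
        ≡⟨ cong (λ y → sumℚ (map (λ k → c′ k * binomℚ y (n ∸ suc (toℕ k))) (allFin n))) Y≡ ⟨
      sumℚ (map (λ k → c′ k * binomℚ (X + ℕ→ℚ n - 1ℚ) (n ∸ suc (toℕ k))) (allFin n))
        ≡⟨ *-cancelˡ-invertible (ℕ→ℚ (size r)) (inv (size r)) (ℕ→ℚ*inv (size r)) (trans (sym (c′-defining X)) (c-defining X)) ⟩
      sumℚ (map (λ k → c k * binomℚ (X + ℕ→ℚ n - 1ℚ) (n ∸ suc (toℕ k))) (allFin n))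
        ≡⟨ cong (λ y → sumℚ (map (λ k → c k * binomℚ y (n ∸ suc (toℕ k))) (allFin n))) Y≡ ⟩
      sumℚ (map (λ k → c k * binomℚ Y (n ∸ suc (toℕ k))) (allFin n))
        ≡⟨ combination n c Y ⟩
      ∑[ e < n ] (extend c (n ∸ suc e) * binomℚ Y e) ∎
      where
      X = Y - ℕ→ℚ n + 1ℚ
      Y≡ : X + ℕ→ℚ n - 1ℚ ≡ Y
      Y≡ = solve 2 (λ Y n → Y :- n :+ con 1ℚ :+ n :- con 1ℚ := Y) refl Y (ℕ→ℚ n)

open Coefficients

mainTheorem3 : (m n : ℕ) → m ≥ 1 → n ≥ 1 → (r : Fin m → ℕ) → size r > 0 →
    Σ (Fin n → ℕ) (λ c →
    Defining n r (λ k → ℕ→ℚ (c k)) ×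
    ((c' : Fin n → ℚ) → Defining n r c' → (k : Fin n) → c' k ≡ ℕ→ℚ (c k)))
mainTheorem3 m n _ _ r |r|>0 =
  c , coefficients-Defining r n , λ c′ c′-defining → Defining-unique n r (coefficients-Defining r n) c′-defining
  where
  instance
    |r|≢0 = >-nonZero |r|>0
  c : Fin n → ℕ
  c k = coefficient (coefficients r) (toℕ k)
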